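{- Let $a\ge4$ be an even integer. The subtraction game $\mathcal{S}(1,a,3a-2)$ is ultimately periodic with period $3a-1$ and nim-sequence $(01)^{a/2-1}\,2\,(01)^{a/2}\,2\,(01)^{a/2-1}\,2$. Moreover, if $a=4$ then the subtraction set is non-expandable; otherwise the subtraction set has expansion $\{1,a,3a-2,3a\}\cup\{4a-1,6a-1\}^{*(3a-1)}$.
   Context: For a finite set $S$ of positive integers, the subtraction game $\mathcal{S}(S)$ is played on a single pile: two players alternately remove $s\in S$ coins (at most the pile size); the last mover wins. The nim-value is $\mathcal{G}(n)=\operatorname{mex}\{\mathcal{G}(n-s): s\in S, s\le n\}$. Words of single digits are written by juxtaposition, and $x^m$ denotes $m$-fold repetition of the block $x$. "The game is ultimately periodic with period $p$ and nim-sequence $W$" ($W$ a word of length $p$) means $p$ is the least positive integer with $\mathcal{G}(n+p)=\mathcal{G}(n)$ for all sufficiently large $n$, and there is $n_0\ge0$ such that $\mathcal{G}(n_0+j)$ is the $((j\bmod p)+1)$-st letter of $W$ for all $j\ge0$. The expansion of $S$ is $S^{ex}=\{s\ge1:\mathcal{G}(n+s)\ne\mathcal{G}(n)\ \forall n\ge0\}$; "has expansion $T$" means $S^{ex}=T$. For a set $X$ and $p\ge1$, $X^{*p}=\{x+mp:x\in X,m\ge0\}$. $S$ is non-expandable if $S^{ex}=S$ or $S^{ex}=S^{*p}$, $p$ the period. -}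

module Defs where

open import Data.Nat using (ℕ; zero; suc; _+_; _*_; _∸_; _≤_; _<_; _≟_)
open import Data.List using (List; []; _∷_; _++_; mapMaybe; length)
open import Data.Maybe using (Maybe; just; nothing)
open import Data.Bool using (Bool; true; false; if_then_else_; _∨_)
open import Data.Product using (Σ; _×_; ∃; _,_)
open import Data.Sum using (_⊎_)
open import Relation.Nullary using (¬_)
open import Relation.Nullary.Decidable using (⌊_⌋)
open import Relation.Binary.PropositionalEquality using (_≡_; _≢_)
open import Data.List.Membership.Propositional using (_∈_)

-- A subtraction set is given as a list of (positive) integers.

nth : List ℕ → ℕ → Maybe ℕ
nth []       _       = nothing
nth (x ∷ xs) zero    = just x
nth (x ∷ xs) (suc i) = nth xs i

elem : ℕ → List ℕ → Bool
elem n []       = false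
elem n (x ∷ xs) = ⌊ n ≟ x ⌋ ∨ elem n xs

-- mex: least natural number not in the list (searched with enough fuel:
-- the mex of a list is at most its length)
mexFrom : ℕ → ℕ → List ℕ → ℕ
mexFrom zero       n l = n
mexFrom (suc fuel) n l = if elem n l then mexFrom fuel (suc n) l else n

mex : List ℕ → ℕ
mex l = mexFrom (suc (length l)) 0 l

-- option value for subtracting s, given prev = [G(n-1), ..., G(0)]:
-- G(n-s) if 1 ≤ s ≤ n, otherwise no option
option : List ℕ → ℕ → Maybe ℕ
option prev zero    = nothing
option prev (suc t) = nth prev t

-- history S n = [G(n-1), G(n-2), ..., G(0)]
history : List ℕ → ℕ → List ℕ
history S zero    = []
history S (suc n) = mex (mapMaybe (option (history S n)) S) ∷ history S n

nimValue : List ℕ → ℕ → ℕ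
nimValue S n = mex (mapMaybe (option (history S n)) S)

IsEventualPeriod : List ℕ → ℕ → Set
IsEventualPeriod S p = ∃ λ n₁ → ∀ n → n₁ ≤ n → nimValue S (n + p) ≡ nimValue S n

IsPeriod : List ℕ → ℕ → Set
IsPeriod S p = 1 ≤ p × IsEventualPeriod S p
             × (∀ q → 1 ≤ q → IsEventualPeriod S q → p ≤ q)

UltimatelyPeriodic : List ℕ → ℕ → List ℕ → Set
UltimatelyPeriodic S p W =
  IsPeriod S p × length W ≡ p
  × ∃ λ n₀ → ∀ m i → i < p → nth W i ≡ just (nimValue S (n₀ + m * p + i))

rep : ℕ → List ℕ → List ℕ
rep zero    w = []
rep (suc m) w = w ++ rep m w

InExpansion : List ℕ → ℕ → Set
InExpansion S s = 1 ≤ s × (∀ n → nimValue S (n + s) ≢ nimValue S n)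

HasExpansion : List ℕ → (ℕ → Set) → Set
HasExpansion S T = ∀ s → (InExpansion S s → T s) × (T s → InExpansion S s)

Star : (ℕ → Set) → ℕ → ℕ → Set
Star X p s = ∃ λ x → ∃ λ m → X x × s ≡ x + m * p

setOf : List ℕ → ℕ → Set
setOf S s = s ∈ S

NonExpandable : List ℕ → Set
NonExpandable S = ∃ λ p → IsPeriod S p
  × (HasExpansion S (setOf S) ⊎ HasExpansion S (Star (setOf S) p))

module Submission where

open import Defs
open import Data.Nat
open import Data.Nat.Properties
open import Data.Nat.Induction using (<-rec)
open import Data.Nat.DivMod using (_%_; _/_; m%n<n; m≡m%n+[m/n]*n; m*n/n≡m)
open import Data.Nat.Divisibility using (_∣_; divides)
open import Data.Nat.Tactic.RingSolver
open import Data.List using (List; []; _∷_; _++_; length; catMaybes; map; mapMaybe)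
open import Data.List.Relation.Unary.All as All using (All)
open import Data.List.Relation.Unary.Any using (Any; here; there)
open import Data.List.Relation.Unary.Any.Properties using (map⁺)
open import Data.List.Membership.Propositional using (_∈_)
open import Data.Maybe using (Maybe; just; nothing)
open import Data.Maybe.Properties using (just-injective)
open import Data.Bool using (Bool; true; false; T; if_then_else_; _∧_)
open import Data.Bool.Properties using (∨-zeroʳ; T-∧)
open import Data.Product using (_×_; ∃; _,_; proj₁; proj₂)
open import Data.Sum using (_⊎_; inj₁; inj₂)
open import Data.Empty using (⊥-elim)
open import Data.Unit using (⊤; tt)
open import Function.Bundles using (Equivalence)
open import Relation.Nullary using (¬_; yes; no)
open import Relation.Nullary.Decidable using (⌊_⌋)
open import Relation.Binary.Definitions using (tri<; tri≈; tri>)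
open import Relation.Binary.PropositionalEquality

bit : ℕ → ℕ
bit zero          = 0
bit (suc zero)    = 1
bit (suc (suc n)) = bit n

bit-flip : ∀ j → bit (suc j) ≢ bit j
bit-flip zero          ()
bit-flip (suc zero)    ()
bit-flip (suc (suc j)) = bit-flip j

bit<2 : ∀ j → bit j < 2
bit<2 zero          = s≤s z≤n
bit<2 (suc zero)    = s≤s (s≤s z≤n)
bit<2 (suc (suc j)) = bit<2 j

big≢bit : ∀ {v} j → 2 ≤ v → v ≢ bit j
big≢bit j 2≤v refl = <⇒≱ (bit<2 j) 2≤v

two≢bit : ∀ j → 2 ≢ bit j
two≢bit j = big≢bit j ≤-refl

three≢bit : ∀ j → 3 ≢ bit j
three≢bit j = big≢bit j (s≤s (s≤s z≤n))

bit-even : ∀ j k → bit (j + k * 2) ≡ bit j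
bit-even j zero    = cong bit (+-identityʳ j)
bit-even j (suc k) = trans (cong bit (trans (+-suc j (suc (k * 2))) (cong suc (+-suc j (k * 2)))))
                           (bit-even j k)

even-or-odd : ∀ j → (∃ λ t → j ≡ t * 2) ⊎ (∃ λ t → j ≡ suc (t * 2))
even-or-odd zero = inj₁ (0 , refl)
even-or-odd (suc j) with even-or-odd j
... | inj₁ (t , e) = inj₂ (t , cong suc e)
... | inj₂ (t , e) = inj₁ (suc t , cong suc e)

elem-head : ∀ v l → elem v (v ∷ l) ≡ true
elem-head v l with v ≟ v
... | yes _ = refl
... | no v≢v = ⊥-elim (v≢v refl)

elem-tail : ∀ v x l → elem v l ≡ true → elem v (x ∷ l) ≡ true
elem-tail v x l e rewrite e = ∨-zeroʳ ⌊ v ≟ x ⌋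

elem-cons-absent : ∀ v x l → v ≢ x → elem v l ≡ false → elem v (x ∷ l) ≡ false
elem-cons-absent v x l v≢x e with v ≟ x
... | yes v≡x = ⊥-elim (v≢x v≡x)
... | no _    = e

elem-cons : ∀ v x l → elem v (x ∷ l) ≡ true → v ≡ x ⊎ elem v l ≡ true
elem-cons v x l e with v ≟ x
... | yes v≡x = inj₁ v≡x
... | no _    = inj₂ e

-- Pigeonhole: a list containing 0, …, N-1 has length at least N.
-- (Proved by deleting the occurrence of N-1 and recursing.)
remove : ℕ → List ℕ → List ℕ
remove x []       = []
remove x (y ∷ ys) = if ⌊ x ≟ y ⌋ then ys else y ∷ remove x ys

remove-length : ∀ x l → elem x l ≡ true → suc (length (remove x l)) ≡ length l
remove-length x []       ()
remove-length x (y ∷ ys) e with x ≟ y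
... | yes _ = refl
... | no _  = cong suc (remove-length x ys e)

remove-keeps : ∀ i x l → i ≢ x → elem i l ≡ true → elem i (remove x l) ≡ true
remove-keeps i x []       i≢x ()
remove-keeps i x (y ∷ ys) i≢x e with x ≟ y | elem-cons i y ys e
... | yes refl | inj₁ refl = ⊥-elim (i≢x refl)
... | yes refl | inj₂ e'   = e'
... | no _     | inj₁ refl = elem-head i (remove x ys)
... | no _     | inj₂ e'   = elem-tail i y (remove x ys) (remove-keeps i x ys i≢x e')

pigeonhole : ∀ N l → (∀ i → i < N → elem i l ≡ true) → N ≤ length l
pigeonhole zero    l all = z≤n
pigeonhole (suc N) l all =
  subst (suc N ≤_) (remove-length N l (all N ≤-refl))
    (s≤s (pigeonhole N (remove N l)
      (λ i i<N → remove-keeps i N l (<⇒≢ i<N) (all i (m<n⇒m<1+n i<N)))))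

mexFrom-below : ∀ f n l → (∀ i → i < n → elem i l ≡ true) →
                ∀ i → i < mexFrom f n l → elem i l ≡ true
mexFrom-below zero    n l below = below
mexFrom-below (suc f) n l below with elem n l in e
... | false = below
... | true  = mexFrom-below f (suc n) l below′
  where
  below′ : ∀ i → i < suc n → elem i l ≡ true
  below′ i i<1+n with m≤n⇒m<n∨m≡n (≤-pred i<1+n)
  ... | inj₁ i<n  = below i i<n
  ... | inj₂ refl = e

mexFrom-stops : ∀ f n l → elem (mexFrom f n l) l ≡ false ⊎ mexFrom f n l ≡ n + f
mexFrom-stops zero    n l = inj₂ (sym (+-identityʳ n))
mexFrom-stops (suc f) n l with elem n l in e
... | false = inj₁ e
... | true with mexFrom-stops f (suc n) l
...   | inj₁ absent = inj₁ absent
...   | inj₂ out    = inj₂ (trans out (sym (+-suc n f)))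

mex-below : ∀ l i → i < mex l → elem i l ≡ true
mex-below l = mexFrom-below (suc (length l)) 0 l (λ i ())

-- the fuel suffices: otherwise 0, …, length l would all occur in l
mex-absent : ∀ l → elem (mex l) l ≡ false
mex-absent l with mexFrom-stops (suc (length l)) 0 l
... | inj₁ absent = absent
... | inj₂ out = ⊥-elim (<-irrefl refl
        (pigeonhole (suc (length l)) l (λ i i< → mex-below l i (subst (i <_) (sym out) i<))))

mex-spec : ∀ l v → (∀ i → i < v → elem i l ≡ true) → elem v l ≡ false → mex l ≡ v
mex-spec l v below absent with <-cmp (mex l) v
... | tri≈ _ m≡v _ = m≡v
... | tri< m<v _ _ with trans (sym (below (mex l) m<v)) (mex-absent l)
...   | ()
mex-spec l v below absent | tri> _ _ v<m with trans (sym (mex-below l v v<m)) absent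
...   | ()

mex-avoids : ∀ l v → elem v l ≡ true → mex l ≢ v
mex-avoids l v present refl with trans (sym present) (mex-absent l)
... | ()

-- Option lists: the options of a position are a list of `Maybe` values
-- (nothing = move not available); `Avoids v o` says o is not the value v.
Avoids : ℕ → Maybe ℕ → Set
Avoids v nothing  = ⊤
Avoids v (just x) = x ≢ v

catMaybes-absent : ∀ v os → All (Avoids v) os → elem v (catMaybes os) ≡ false
catMaybes-absent v []             All.[]          = refl
catMaybes-absent v (nothing ∷ os) (_ All.∷ av)   = catMaybes-absent v os av
catMaybes-absent v (just x ∷ os)  (x≢v All.∷ av) =
  elem-cons-absent v x (catMaybes os) (λ v≡x → x≢v (sym v≡x)) (catMaybes-absent v os av)

catMaybes-present : ∀ v os → Any (_≡ just v) os → elem v (catMaybes os) ≡ true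
catMaybes-present v (just .v ∷ os) (here refl) = elem-head v (catMaybes os)
catMaybes-present v (nothing ∷ os) (there p)   = catMaybes-present v os p
catMaybes-present v (just x ∷ os)  (there p)   = elem-tail v x (catMaybes os) (catMaybes-present v os p)

mex-after : ∀ j os → All (Avoids (bit (suc j))) os →
            mex (catMaybes (just (bit j) ∷ os)) ≡ bit (suc j)
mex-after j os av =
  mex-spec (bit j ∷ catMaybes os) (bit (suc j)) (below j)
    (elem-cons-absent _ _ (catMaybes os) (bit-flip j) (catMaybes-absent _ os av))
  where
  below : ∀ j i → i < bit (suc j) → elem i (bit j ∷ catMaybes os) ≡ true
  below zero          .0 (s≤s z≤n) = elem-head 0 (catMaybes os)
  below (suc zero)    i  ()
  below (suc (suc j)) i  i<      = below j i i<

history-nth : ∀ S m t → nth (history S (m + suc t)) t ≡ just (nimValue S m)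
history-nth S m zero    rewrite +-comm m 1 = refl
history-nth S m (suc t) rewrite +-suc m (suc t) = history-nth S m t

history-short : ∀ S n t → n ≤ t → nth (history S n) t ≡ nothing
history-short S zero    t       _         = refl
history-short S (suc n) (suc t) (s≤s n≤t) = history-short S n t n≤t

-- Certificate checking: a claimed history (values listed from n-1 down to
-- 0, as in `history`) is verified in one pass by recomputing each mex from
-- the claimed earlier values; this is much cheaper than evaluating nimValue.
consistent : List ℕ → List ℕ → Bool
consistent S []      = true
consistent S (v ∷ h) = (v ≡ᵇ mex (mapMaybe (option h) S)) ∧ consistent S h

consistent-history : ∀ S h → T (consistent S h) → history S (length h) ≡ h
consistent-history S []      _  = refl
consistent-history S (v ∷ h) ok with Equivalence.to T-∧ ok
... | head-ok , tail-ok rewrite consistent-history S h tail-ok =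
  cong (_∷ h) (sym (≡ᵇ⇒≡ v _ head-ok))

consistent-value : ∀ S h → T (consistent S h) → ∀ n t → n + suc t ≡ length h →
                   nth h t ≡ just (nimValue S n)
consistent-value S h ok n t len =
  subst (λ h′ → nth h′ t ≡ just (nimValue S n))
    (trans (cong (history S) len) (consistent-history S h ok)) (history-nth S n t)

module ThreeMove (A C : ℕ) where

  S : List ℕ
  S = 1 ∷ A ∷ C ∷ []

  -- They are opaque so that symbolic positions such
  -- as 19 + 6k are never unfolded by the type checker.
  opaque
    G : ℕ → ℕ
    G = nimValue S

    Opt : ℕ → ℕ → Maybe ℕ
    Opt n s = option (history S n) s

  opaque
    unfolding G Opt

    G≡nimValue : ∀ n → nimValue S n ≡ G n
    G≡nimValue n = refl

    Opt-move : ∀ m s → 1 ≤ s → Opt (m + s) s ≡ just (G m)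
    Opt-move m (suc t) _ = history-nth S m t

    Opt-none : ∀ n s → n < s → Opt n s ≡ nothing
    Opt-none n (suc t) (s≤s n≤t) = history-short S n t n≤t

    G-mex : ∀ n → G n ≡ mex (catMaybes (map (Opt n) S))
    G-mex n = refl

  avoids : ∀ {n s v w} → Opt n s ≡ just v → v ≢ w → Avoids w (Opt n s)
  avoids e v≢w rewrite e = v≢w

  avoids-nothing : ∀ {n s w} → Opt n s ≡ nothing → Avoids w (Opt n s)
  avoids-nothing e rewrite e = tt

  values-differ : ∀ {x y v w} → G x ≡ v → G y ≡ w → v ≢ w → G x ≢ G y
  values-differ G≡v G≡w v≢w G≡G = v≢w (trans (sym G≡v) (trans G≡G G≡w))

  G-from : ∀ n {x y z} → Opt n 1 ≡ x → Opt n A ≡ y → Opt n C ≡ z →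
           G n ≡ mex (catMaybes (x ∷ y ∷ z ∷ []))
  G-from n refl refl refl = G-mex n

  -- A run may start at b when b = 0 or G(b-1) ≠ 0: then 0 is not the 1-option.
  RunStart : ℕ → Set
  RunStart b = b ≡ 0 ⊎ ∃ λ b′ → b ≡ suc b′ × G b′ ≢ 0

  start-after : ∀ b {v} → G b ≡ v → v ≢ 0 → RunStart (suc b)
  start-after b G≡v v≢0 = inj₂ (b , refl , λ G≡0 → v≢0 (trans (sym G≡v) G≡0))

  run : ∀ b L → RunStart b →
        (∀ j → j < L → Avoids (bit j) (Opt (b + j) A) × Avoids (bit j) (Opt (b + j) C)) →
        ∀ j → j < L → G (b + j) ≡ bit j
  run b L start avoid zero 0<L =
    trans (G-mex (b + 0))
      (mex-spec (catMaybes (map (Opt (b + 0)) S)) 0 (λ _ ()) (catMaybes-absent 0 (map (Opt (b + 0)) S)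
        (first-option start All.∷ proj₁ (avoid 0 0<L) All.∷ proj₂ (avoid 0 0<L) All.∷ All.[])))
    where
    first-option : RunStart b → Avoids 0 (Opt (b + 0) 1)
    first-option (inj₁ refl) rewrite Opt-none 0 1 (s≤s z≤n) = tt
    first-option (inj₂ (b′ , refl , G≢0)) = subst (Avoids 0) (sym previous) G≢0
      where
      previous : Opt (suc b′ + 0) 1 ≡ just (G b′)
      previous = trans (cong (λ x → Opt x 1) (trans (+-identityʳ (suc b′)) (+-comm 1 b′)))
                       (Opt-move b′ 1 (s≤s z≤n))
  run b L start avoid (suc j) j<L =
    trans (G-mex (b + suc j))
      (trans (cong (λ o → mex (catMaybes (o ∷ Opt (b + suc j) A ∷ Opt (b + suc j) C ∷ []))) previous)
        (mex-after j (Opt (b + suc j) A ∷ Opt (b + suc j) C ∷ [])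
              (proj₁ (avoid (suc j) j<L) All.∷ proj₂ (avoid (suc j) j<L) All.∷ All.[])))
    where
    previous : Opt (b + suc j) 1 ≡ just (bit j)
    previous = begin
      Opt (b + suc j) 1   ≡⟨ cong (λ x → Opt x 1) (trans (+-suc b j) (+-comm 1 (b + j))) ⟩
      Opt (b + j + 1) 1   ≡⟨ Opt-move (b + j) 1 (s≤s z≤n) ⟩
      just (G (b + j))    ≡⟨ cong just (run b L start avoid j (<-trans (n<1+n j) j<L)) ⟩
      just (bit j)        ∎
      where open ≡-Reasoning

  move-changes-value : ∀ n s → s ∈ S → 1 ≤ s → G (n + s) ≢ G n
  move-changes-value n s s∈S 1≤s G≡ =
    mex-avoids (catMaybes (map (Opt (n + s)) S)) (G n)
      (catMaybes-present (G n) (map (Opt (n + s)) S)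
        (map⁺ {f = Opt (n + s)} (Data.List.Relation.Unary.Any.map (λ { refl → Opt-move n s 1≤s }) s∈S)))
      (trans (sym (G-mex (n + s))) G≡)

  -- Periodicity propagates: G depends only on the C preceding values, so if
  -- G(n+p) = G(n) on a window [n₁, n₁+C) it holds for every n ≥ n₁.
  periodic-from-window : ∀ n₁ p → 1 ≤ A → A ≤ C →
    (∀ n → n₁ ≤ n → n < n₁ + C → G (n + p) ≡ G n) →
    ∀ n → n₁ ≤ n → G (n + p) ≡ G n
  periodic-from-window n₁ p 1≤A A≤C window = <-rec _ step
    where
    step : ∀ n → (∀ {m} → m < n → n₁ ≤ m → G (m + p) ≡ G m) → n₁ ≤ n → G (n + p) ≡ G n
    step n earlier n₁≤n with n <? n₁ + C
    ... | yes inside = window n n₁≤n inside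
    ... | no outside = begin
      G (n + p)                                                ≡⟨ G-mex (n + p) ⟩
      mex (catMaybes (Opt (n + p) 1 ∷ Opt (n + p) A ∷ Opt (n + p) C ∷ []))
        ≡⟨ cong₃ (λ x y z → mex (catMaybes (x ∷ y ∷ z ∷ [])))
                 (shift 1 (s≤s z≤n) (≤-trans 1≤A A≤C)) (shift A 1≤A A≤C) (shift C (≤-trans 1≤A A≤C) ≤-refl) ⟩
      mex (catMaybes (Opt n 1 ∷ Opt n A ∷ Opt n C ∷ []))     ≡⟨ sym (G-mex n) ⟩
      G n                                                      ∎
      where
      open ≡-Reasoning
      cong₃ : ∀ (f : Maybe ℕ → Maybe ℕ → Maybe ℕ → ℕ) {x x′ y y′ z z′} →
              x ≡ x′ → y ≡ y′ → z ≡ z′ → f x y z ≡ f x′ y′ z′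
      cong₃ f refl refl refl = refl
      -- the option for s is G(n - s), and n - s ≥ n₁ lies in the inductive range
      shift : ∀ s → 1 ≤ s → s ≤ C → Opt (n + p) s ≡ Opt n s
      shift s 1≤s s≤C = begin
        Opt (n + p) s         ≡⟨ cong (λ x → Opt x s) (sym shifted) ⟩
        Opt (m + p + s) s     ≡⟨ Opt-move (m + p) s 1≤s ⟩
        just (G (m + p))      ≡⟨ cong just (earlier m<n n₁≤m) ⟩
        just (G m)            ≡⟨ sym (Opt-move m s 1≤s) ⟩
        Opt (m + s) s         ≡⟨ cong (λ x → Opt x s) m+s≡n ⟩
        Opt n s               ∎
        where
        far : n₁ + C ≤ n
        far = ≮⇒≥ outside
        m = n ∸ s
        m+s≡n : m + s ≡ n
        m+s≡n = m∸n+n≡m (≤-trans s≤C (≤-trans (m≤n+m C n₁) far))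
        shifted : m + p + s ≡ n + p
        shifted = trans (+-assoc m p s) (trans (cong (m +_) (+-comm p s))
                    (trans (sym (+-assoc m s p)) (cong (_+ p) m+s≡n)))
        m<n : m < n
        m<n = subst (m <_) m+s≡n (m<m+n m 1≤s)
        n₁≤m : n₁ ≤ m
        n₁≤m = +-cancelʳ-≤ s n₁ m (subst (n₁ + s ≤_) (sym m+s≡n) (≤-trans (+-monoʳ-≤ n₁ s≤C) far))

  periodic-multiple : ∀ n₁ p → (∀ n → n₁ ≤ n → G (n + p) ≡ G n) →
                      ∀ m x → n₁ ≤ x → G (x + m * p) ≡ G x
  periodic-multiple n₁ p per zero    x n₁≤x = cong G (+-identityʳ x)
  periodic-multiple n₁ p per (suc m) x n₁≤x = begin
    G (x + (p + m * p))   ≡⟨ cong G (trans (cong (x +_) (+-comm p (m * p))) (sym (+-assoc x (m * p) p))) ⟩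
    G (x + m * p + p)     ≡⟨ per (x + m * p) (≤-trans n₁≤x (m≤m+n x (m * p))) ⟩
    G (x + m * p)         ≡⟨ periodic-multiple n₁ p per m x n₁≤x ⟩
    G x                   ∎
    where open ≡-Reasoning

  eventual-period : ∀ n₁ p → (∀ n → n₁ ≤ n → G (n + p) ≡ G n) → IsEventualPeriod S p
  eventual-period n₁ p per = n₁ , λ n n₁≤n →
    trans (G≡nimValue (n + p)) (trans (per n n₁≤n) (sym (G≡nimValue n)))

  in-expansion : ∀ s → 1 ≤ s → (∀ n → G (n + s) ≢ G n) → InExpansion S s
  in-expansion s 1≤s changes = 1≤s , λ n e →
    changes n (trans (sym (G≡nimValue (n + s))) (trans e (G≡nimValue n)))

  expansion-changes : ∀ s → InExpansion S s → ∀ n → G (n + s) ≢ G n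
  expansion-changes s (_ , changes) n e =
    changes n (trans (G≡nimValue (n + s)) (trans e (sym (G≡nimValue n))))

  move-in-expansion : ∀ s → s ∈ S → 1 ≤ s → InExpansion S s
  move-in-expansion s s∈S 1≤s = in-expansion s 1≤s (λ n → move-changes-value n s s∈S 1≤s)

  -- Any eventual period q already holds from every start n₀ from which a
  -- period p ≥ 1 holds: compare x and x + q far out, n₁·p steps later.
  period-from-start : ∀ n₀ p → 1 ≤ p → (∀ n → n₀ ≤ n → G (n + p) ≡ G n) →
                      ∀ q → IsEventualPeriod S q → ∀ x → n₀ ≤ x → G (x + q) ≡ G x
  period-from-start n₀ p 1≤p per q (n₁ , perq) x n₀≤x = begin
    G (x + q)               ≡⟨ sym (periodic-multiple n₀ p per n₁ (x + q) (≤-trans n₀≤x (m≤m+n x q))) ⟩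
    G (x + q + n₁ * p)      ≡⟨ cong G (trans (+-assoc x q _) (trans (cong (x +_) (+-comm q _)) (sym (+-assoc x _ q)))) ⟩
    G (x + n₁ * p + q)      ≡⟨ sym (G≡nimValue _) ⟩
    nimValue S (x + n₁ * p + q) ≡⟨ perq (x + n₁ * p) (≤-trans n₁≤n₁p (m≤n+m _ x)) ⟩
    nimValue S (x + n₁ * p) ≡⟨ G≡nimValue _ ⟩
    G (x + n₁ * p)          ≡⟨ periodic-multiple n₀ p per n₁ x n₀≤x ⟩
    G x                     ∎
    where
    open ≡-Reasoning
    n₁≤n₁p : n₁ ≤ n₁ * p
    n₁≤n₁p = subst (_≤ n₁ * p) (*-identityʳ n₁) (*-monoʳ-≤ n₁ 1≤p)

  least-period : ∀ n₀ p → 1 ≤ p → (∀ n → n₀ ≤ n → G (n + p) ≡ G n) →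
    (∀ q → 1 ≤ q → q < p → ∃ λ x → n₀ ≤ x × G (x + q) ≢ G x) → IsPeriod S p
  least-period n₀ p 1≤p per fails = 1≤p , eventual-period n₀ p per , minimal
    where
    minimal : ∀ q → 1 ≤ q → IsEventualPeriod S q → p ≤ q
    minimal q 1≤q perq with p ≤? q
    ... | yes p≤q = p≤q
    ... | no  p≰q with fails q 1≤q (≰⇒> p≰q)
    ...   | x , n₀≤x , G≢ = ⊥-elim (G≢ (period-from-start n₀ p 1≤p per q perq x n₀≤x))

  ultimately-periodic : ∀ n₀ p W → IsPeriod S p → (∀ n → n₀ ≤ n → G (n + p) ≡ G n) →
    length W ≡ p → (∀ i → i < p → nth W i ≡ just (G (n₀ + i))) → UltimatelyPeriodic S p W
  ultimately-periodic n₀ p W isPeriod per len word = isPeriod , len , n₀ , λ m i i<p → begin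
    nth W i                       ≡⟨ word i i<p ⟩
    just (G (n₀ + i))             ≡⟨ cong just (sym (periodic-multiple n₀ p per m (n₀ + i) (m≤m+n n₀ i))) ⟩
    just (G (n₀ + i + m * p))     ≡⟨ cong just (cong G
          (trans (+-assoc n₀ i _) (trans (cong (n₀ +_) (+-comm i _)) (sym (+-assoc n₀ _ i))))) ⟩
    just (G (n₀ + m * p + i))     ≡⟨ cong just (sym (G≡nimValue _)) ⟩
    just (nimValue S (n₀ + m * p + i)) ∎
    where open ≡-Reasoning

  expansion-residue : ∀ n₀ p → (∀ n → n₀ ≤ n → G (n + p) ≡ G n) →
    ∀ ρ m → (∀ n → G (n + (ρ + m * p)) ≢ G n) → ∀ x → n₀ ≤ x → G (x + ρ) ≢ G x
  expansion-residue n₀ p per ρ m changes x n₀≤x e =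
    changes x (trans (cong G (sym (+-assoc x ρ (m * p))))
                (trans (periodic-multiple n₀ p per m (x + ρ) (≤-trans n₀≤x (m≤m+n x ρ))) e))

-- Order facts whose side conditions are equations, to be discharged by the
-- ring solver.
-- x ≤ y, witnessed by the difference d
≤-by : ∀ x y d → y ≡ x + d → x ≤ y
≤-by x .(x + d) d refl = m≤m+n x d

split-last : ∀ j L → j < suc L → j < L ⊎ j ≡ L
split-last j L j<1+L = m≤n⇒m<n∨m≡n (≤-pred j<1+L)

<-weaken : ∀ {x y} → x < y → ∀ x′ y′ a b → x ≡ x′ + a → y′ ≡ y + b → x′ < y′
<-weaken {x} {y} x<y x′ y′ a b x≡ y′≡ = ≤-trans (s≤s (≤-by x′ x a x≡)) (≤-trans x<y (≤-by y y′ b y′≡))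

shifted-below : ∀ b j L c → j < L → b + L ≤ c → b + j < c
shifted-below b j L c j<L b+L≤c = ≤-trans (+-monoʳ-< b j<L) b+L≤c

-- Opaque: the
-- witnesses are only used through their equations, and unfolding them
-- inside symbolic positions makes type checking blow up.
opaque
  below-or-beyond : ∀ d c → d < c ⊎ ∃ λ e → d ≡ c + e
  below-or-beyond d c with d <? c
  ... | yes d<c = inj₁ d<c
  ... | no  d≮c = inj₂ (d ∸ c , sym (m+[n∸m]≡n (≮⇒≥ d≮c)))

  offset : ∀ b n → b ≤ n → ∃ λ d → n ≡ b + d
  offset b n b≤n = n ∸ b , sym (m+[n∸m]≡n b≤n)

alternating-length : ∀ m w → length (rep m (0 ∷ 1 ∷ []) ++ w) ≡ m * 2 + length w
alternating-length zero    w = refl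
alternating-length (suc m) w = cong (λ t → suc (suc t)) (alternating-length m w)

alternating-nth : ∀ m w i → i < m * 2 → nth (rep m (0 ∷ 1 ∷ []) ++ w) i ≡ just (bit i)
alternating-nth (suc m) w zero          _              = refl
alternating-nth (suc m) w (suc zero)    _              = refl
alternating-nth (suc m) w (suc (suc i)) (s≤s (s≤s i<)) = alternating-nth m w i i<

alternating-skip : ∀ m w i → nth (rep m (0 ∷ 1 ∷ []) ++ w) (m * 2 + i) ≡ nth w i
alternating-skip zero    w i = refl
alternating-skip (suc m) w i = alternating-skip m w i

-- The case a = 4, i.e. S(1, 4, 10): everything follows from the values
-- G(0), …, G(36), certified by evaluation.
--   n    : 0 1 2 3 4 5 6 7 8 9 10 11 12 13 14 15 | 16 …  26 | 27 …
--   G(n) : 0 1 0 1 2 0 1 0 1 2 3  2  3  0  1  3  | 0 1 0 1 2 0 1 2 0 1 2 | repeat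
module CaseFour where

  open ThreeMove 4 10 public

  -- G(36), G(35), …, G(0), certified by a single evaluation of `consistent`
  table : List ℕ
  table = 1 ∷ 0 ∷ 2 ∷ 1 ∷ 0 ∷ 2 ∷ 1 ∷ 0 ∷ 1 ∷ 0 ∷ 2 ∷ 1 ∷ 0 ∷ 2 ∷ 1 ∷ 0 ∷ 2 ∷ 1 ∷ 0
        ∷ 1 ∷ 0 ∷ 3 ∷ 1 ∷ 0 ∷ 3 ∷ 2 ∷ 3 ∷ 2 ∷ 1 ∷ 0 ∷ 1 ∷ 0 ∷ 2 ∷ 1 ∷ 0 ∷ 1 ∷ 0 ∷ []

  value : ∀ n {n<37 : T (n <ᵇ 37)} → nth table (36 ∸ n) ≡ just (G n)
  value n {n<37} = trans (consistent-value S table _ n (36 ∸ n) length-ok) (cong just (G≡nimValue n))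
    where
    length-ok : n + suc (36 ∸ n) ≡ 37
    length-ok = trans (+-suc n (36 ∸ n)) (cong suc (m+[n∸m]≡n (≤-pred (<ᵇ⇒< n 37 n<37))))

  agree : ∀ x y {x<37 : T (x <ᵇ 37)} {y<37 : T (y <ᵇ 37)} →
          nth table (36 ∸ x) ≡ nth table (36 ∸ y) → G x ≡ G y
  agree x y {x<37} {y<37} e =
    just-injective (trans (sym (value x {x<37})) (trans e (value y {y<37})))

  differ : ∀ x y {x<37 : T (x <ᵇ 37)} {y<37 : T (y <ᵇ 37)} →
           nth table (36 ∸ x) ≢ nth table (36 ∸ y) → G x ≢ G y
  differ x y {x<37} {y<37} ne e =
    ne (trans (value x {x<37}) (trans (cong just e) (sym (value y {y<37}))))

  window : ∀ d → d < 10 → G (16 + d + 11) ≡ G (16 + d)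
  window 0 _ = agree _ _ refl
  window 1 _ = agree _ _ refl
  window 2 _ = agree _ _ refl
  window 3 _ = agree _ _ refl
  window 4 _ = agree _ _ refl
  window 5 _ = agree _ _ refl
  window 6 _ = agree _ _ refl
  window 7 _ = agree _ _ refl
  window 8 _ = agree _ _ refl
  window 9 _ = agree _ _ refl
  window (suc (suc (suc (suc (suc (suc (suc (suc (suc (suc _))))))))))
      (s≤s (s≤s (s≤s (s≤s (s≤s (s≤s (s≤s (s≤s (s≤s (s≤s ()))))))))))

  periodic : ∀ n → 16 ≤ n → G (n + 11) ≡ G n
  periodic = periodic-from-window 16 11 (s≤s z≤n) (≤ᵇ⇒≤ 4 10 _) λ n 16≤n n<26 →
    let (d , 16+d≡n) = m≤n⇒∃[o]m+o≡n 16≤n in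
    subst (λ x → G (x + 11) ≡ G x) 16+d≡n
      (window d (+-cancelˡ-< 16 d 10 (subst (_< 26) (sym 16+d≡n) n<26)))

  smaller-shift-fails : ∀ q → 1 ≤ q → q < 11 → ∃ λ x → 16 ≤ x × G (x + q) ≢ G x
  smaller-shift-fails 1  _ _ = 16 , ≤-refl , differ _ _ (λ ())
  smaller-shift-fails 2  _ _ = 18 , ≤ᵇ⇒≤ 16 18 _ , differ _ _ (λ ())
  smaller-shift-fails 3  _ _ = 16 , ≤-refl , differ _ _ (λ ())
  smaller-shift-fails 4  _ _ = 16 , ≤-refl , differ _ _ (λ ())
  smaller-shift-fails 5  _ _ = 18 , ≤ᵇ⇒≤ 16 18 _ , differ _ _ (λ ())
  smaller-shift-fails 6  _ _ = 16 , ≤-refl , differ _ _ (λ ())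
  smaller-shift-fails 7  _ _ = 16 , ≤-refl , differ _ _ (λ ())
  smaller-shift-fails 8  _ _ = 18 , ≤ᵇ⇒≤ 16 18 _ , differ _ _ (λ ())
  smaller-shift-fails 9  _ _ = 16 , ≤-refl , differ _ _ (λ ())
  smaller-shift-fails 10 _ _ = 16 , ≤-refl , differ _ _ (λ ())
  smaller-shift-fails (suc (suc (suc (suc (suc (suc (suc (suc (suc (suc (suc _))))))))))) _
      (s≤s (s≤s (s≤s (s≤s (s≤s (s≤s (s≤s (s≤s (s≤s (s≤s (s≤s ())))))))))))

  isPeriod : IsPeriod S 11
  isPeriod = least-period 16 11 (s≤s z≤n) periodic smaller-shift-fails

  word : List ℕ
  word = rep 1 (0 ∷ 1 ∷ []) ++ (2 ∷ []) ++ rep 2 (0 ∷ 1 ∷ []) ++ (2 ∷ [])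
           ++ rep 1 (0 ∷ 1 ∷ []) ++ (2 ∷ [])

  word-values : ∀ i → i < 11 → nth word i ≡ just (G (24 + i))
  word-values 0  _ = value 24
  word-values 1  _ = value 25
  word-values 2  _ = value 26
  word-values 3  _ = value 27
  word-values 4  _ = value 28
  word-values 5  _ = value 29
  word-values 6  _ = value 30
  word-values 7  _ = value 31
  word-values 8  _ = value 32
  word-values 9  _ = value 33
  word-values 10 _ = value 34
  word-values (suc (suc (suc (suc (suc (suc (suc (suc (suc (suc (suc _)))))))))))
      (s≤s (s≤s (s≤s (s≤s (s≤s (s≤s (s≤s (s≤s (s≤s (s≤s (s≤s ())))))))))))

  ultimatelyPeriodic : UltimatelyPeriodic S 11 word
  ultimatelyPeriodic = ultimately-periodic 24 11 word isPeriod
    (λ n 24≤n → periodic n (≤-trans (≤ᵇ⇒≤ 16 24 _) 24≤n)) refl word-values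

  repeat-in-period : ∀ ρ m x → 16 ≤ x → G (x + ρ) ≡ G x →
                     ¬ (∀ n → G (n + (ρ + m * 11)) ≢ G n)
  repeat-in-period ρ m x 16≤x e changes = expansion-residue 16 11 periodic ρ m changes x 16≤x e

  -- for m ≥ 1 the shift ρ + 11m acts on n like ρ + 11, which may repeat a
  -- transient value
  repeat-in-transient : ∀ ρ m n → 16 ≤ n + (ρ + 11) → G (n + (ρ + 11)) ≡ G n →
                        ¬ (∀ n′ → G (n′ + (ρ + suc m * 11)) ≢ G n′)
  repeat-in-transient ρ m n 16≤ e changes =
    changes n (trans (cong G (shift-assoc n ρ (m * 11))) (trans (periodic-multiple 16 11 periodic m _ 16≤) e))
    where
    shift-assoc : ∀ n ρ x → n + (ρ + (11 + x)) ≡ n + (ρ + 11) + x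
    shift-assoc n ρ x = trans (cong (n +_) (sym (+-assoc ρ 11 x))) (sym (+-assoc n (ρ + 11) x))

  residue-classes : ∀ ρ m → ρ < 11 → (∀ n → G (n + (ρ + m * 11)) ≢ G n) → ρ + m * 11 ∈ S
  residue-classes 0  m       _ ch = ⊥-elim (repeat-in-period 0 m 16 ≤-refl (agree 16 16 refl) ch)
  residue-classes 1  zero    _ ch = here refl
  residue-classes 1  (suc m) _ ch = ⊥-elim (repeat-in-transient 1 m 11 (≤ᵇ⇒≤ 16 23 _) (agree 23 11 refl) ch)
  residue-classes 2  m       _ ch = ⊥-elim (repeat-in-period 2 m 16 ≤-refl (agree 18 16 refl) ch)
  residue-classes 3  m       _ ch = ⊥-elim (repeat-in-period 3 m 18 (≤ᵇ⇒≤ 16 18 _) (agree 21 18 refl) ch)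
  residue-classes 4  zero    _ ch = there (here refl)
  residue-classes 4  (suc m) _ ch = ⊥-elim (repeat-in-transient 4 m 11 (≤ᵇ⇒≤ 16 26 _) (agree 26 11 refl) ch)
  residue-classes 5  m       _ ch = ⊥-elim (repeat-in-period 5 m 16 ≤-refl (agree 21 16 refl) ch)
  residue-classes 6  m       _ ch = ⊥-elim (repeat-in-period 6 m 18 (≤ᵇ⇒≤ 16 18 _) (agree 24 18 refl) ch)
  residue-classes 7  zero    _ ch = ⊥-elim (ch 0 (agree 7 0 refl))
  residue-classes 7  (suc m) _ ch = ⊥-elim (repeat-in-transient 7 m 0 (≤ᵇ⇒≤ 16 18 _) (agree 18 0 refl) ch)
  residue-classes 8  m       _ ch = ⊥-elim (repeat-in-period 8 m 16 ≤-refl (agree 24 16 refl) ch)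
  residue-classes 9  m       _ ch = ⊥-elim (repeat-in-period 9 m 18 (≤ᵇ⇒≤ 16 18 _) (agree 27 18 refl) ch)
  residue-classes 10 zero    _ ch = there (there (here refl))
  residue-classes 10 (suc m) _ ch = ⊥-elim (repeat-in-transient 10 m 0 (≤ᵇ⇒≤ 16 21 _) (agree 21 0 refl) ch)
  residue-classes (suc (suc (suc (suc (suc (suc (suc (suc (suc (suc (suc _))))))))))) _
      (s≤s (s≤s (s≤s (s≤s (s≤s (s≤s (s≤s (s≤s (s≤s (s≤s (s≤s ()))))))))))) _

  expansion : HasExpansion S (setOf S)
  expansion s = to , from
    where
    to : InExpansion S s → s ∈ S
    to ex = subst (_∈ S) (sym (m≡m%n+[m/n]*n s 11))
              (residue-classes (s % 11) (s / 11) (m%n<n s 11)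
                (subst (λ t → ∀ n → G (n + t) ≢ G n) (m≡m%n+[m/n]*n s 11) (expansion-changes s ex)))
    from : s ∈ S → InExpansion S s
    from s∈S@(here refl)                 = move-in-expansion s s∈S (s≤s z≤n)
    from s∈S@(there (here refl))         = move-in-expansion s s∈S (s≤s z≤n)
    from s∈S@(there (there (here refl))) = move-in-expansion s s∈S (s≤s z≤n)

  nonExpandable : NonExpandable S
  nonExpandable = 11 , isPeriod , inj₁ expansion

-- The case a = A = 6 + 2k, C = 3A - 2, P = 3A - 1.  Positions are written
-- with k so that the ring solver can normalise them; the names use A.
--   segment    : [0,A)  A  [A+1,2A+1)  2A+1  [2A+2,3A-2)  3A-2  3A-1  3A
--   values     : 0101…  2  0101…       2     0101…        2     3     2
--   period block from 3A (offsets d < P; repeated from 6A-1 = 3A + P on):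
--   d          : 0  [1,A-1)  A-1  [A,2A)  2A  [2A+1,3A-1)
--   values     : 2  0101…    2    0101…   2   0101…
-- Each run is obtained from `run` by checking that its A- and C-options
-- (read off earlier segments) never equal the parity bit; each isolated
-- value is a single mex of three known options.
module CaseEven (k : ℕ) where

  A : ℕ
  A = 6 + k * 2

  C : ℕ
  C = 3 * A ∸ 2

  P : ℕ
  P = 3 * A ∸ 1

  open ThreeMove A C public

  -- (the left-hand sides are the normal forms of C and P)
  C≡ : C ≡ 16 + k * 6
  C≡ = normal-form k
    where
    normal-form : ∀ k → 4 + (k * 2 + (6 + (k * 2 + (6 + (k * 2 + 0))))) ≡ 16 + k * 6
    normal-form = solve-∀

  P≡ : P ≡ 17 + k * 6
  P≡ = normal-form k
    where
    normal-form : ∀ k → 5 + (k * 2 + (6 + (k * 2 + (6 + (k * 2 + 0))))) ≡ 17 + k * 6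
    normal-form = solve-∀

  opt-1 : ∀ n m {v} → n ≡ m + 1 → G m ≡ v → Opt n 1 ≡ just v
  opt-1 n m refl G≡v = trans (Opt-move m 1 (s≤s z≤n)) (cong just G≡v)

  opt-A : ∀ n m {v} → n ≡ m + (6 + k * 2) → G m ≡ v → Opt n A ≡ just v
  opt-A n m refl G≡v = trans (Opt-move m A (s≤s z≤n)) (cong just G≡v)

  opt-C : ∀ n m {v} → n ≡ m + (16 + k * 6) → G m ≡ v → Opt n C ≡ just v
  opt-C n m n≡ G≡v = trans (cong (λ x → Opt x C) (trans n≡ (cong (m +_) (sym C≡))))
                       (trans (Opt-move m C (subst (1 ≤_) (sym C≡) (s≤s z≤n))) (cong just G≡v))

  none-A : ∀ n → n < 6 + k * 2 → Opt n A ≡ nothing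
  none-A n n<A = Opt-none n A n<A

  none-C : ∀ n → n < 16 + k * 6 → Opt n C ≡ nothing
  none-C n n<C = Opt-none n C (subst (n <_) (sym C≡) n<C)

  moved : ∀ m n {v} → m ≡ n → G n ≡ v → G m ≡ v
  moved m .m refl G≡v = G≡v

  -- [0, A): no A- or C-move is available yet
  run-0 : ∀ j → j < 6 + k * 2 → G j ≡ bit j
  run-0 = run 0 (6 + k * 2) (inj₁ refl) avoid
    where
    avoid : ∀ j → j < 6 + k * 2 → Avoids (bit j) (Opt j A) × Avoids (bit j) (Opt j C)
    avoid j j< = avoids-nothing (none-A j j<) , avoids-nothing
        (none-C j (≤-trans j< (≤-by (6 + k * 2) (16 + k * 6) (10 + k * 4) (solve (k ∷ [])))))

  -- G(A) = mex{G(A-1), G(0)} = mex{1, 0}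
  G-A : G (6 + k * 2) ≡ 2
  G-A = G-from (6 + k * 2) (opt-1 (6 + k * 2) (5 + k * 2) (solve (k ∷ []))
        (trans (run-0 (5 + k * 2) (n<1+n _)) (bit-even 5 k)))
            (opt-A (6 + k * 2) 0 refl (run-0 0 (s≤s z≤n)))
            (none-C (6 + k * 2) (≤-by (7 + k * 2) (16 + k * 6) (9 + k * 4) (solve (k ∷ []))))

  -- [A+1, 2A+1): the A-options form the run [1, A) followed by G(A) = 2
  run-A+1 : ∀ j → j < 6 + k * 2 → G (7 + k * 2 + j) ≡ bit j
  run-A+1 = run (7 + k * 2) (6 + k * 2) (start-after (6 + k * 2) G-A (λ ())) avoid
    where
    avoid : ∀ j → j < 6 + k * 2 → Avoids (bit j) (Opt (7 + k * 2 + j) A) × Avoids (bit j) (Opt (7 + k * 2 + j) C)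
    avoid j j< = via-A (split-last (suc j) (6 + k * 2) (s≤s j<)) , avoids-nothing
        (none-C (7 + k * 2 + j) (shifted-below (7 + k * 2) j (6 + k * 2) (16 + k * 6) j<
                (≤-by (7 + k * 2 + (6 + k * 2)) (16 + k * 6) (3 + k * 2) (solve (k ∷ [])))))
      where
      via-A : suc j < 6 + k * 2 ⊎ suc j ≡ 6 + k * 2 → Avoids (bit j) (Opt (7 + k * 2 + j) A)
      via-A (inj₁ j<′) = avoids (opt-A (7 + k * 2 + j) (suc j) (solve (k ∷ j ∷ [])) (run-0 (suc j) j<′)) (bit-flip j)
      via-A (inj₂ e) = avoids (opt-A (7 + k * 2 + j) (suc j) (solve (k ∷ j ∷ [])) (moved (suc j) (6 + k * 2) e G-A))
          (two≢bit j)

  -- G(2A+1) = mex{G(2A), G(A+1)} = mex{1, 0}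
  G-2A+1 : G (13 + k * 4) ≡ 2
  G-2A+1 = G-from (13 + k * 4) (opt-1 (13 + k * 4) (12 + k * 4) (solve (k ∷ []))
        (moved (12 + k * 4) (7 + k * 2 + (5 + k * 2)) (solve (k ∷ []))
              (trans (run-A+1 (5 + k * 2) (n<1+n _)) (bit-even 5 k))))
            (opt-A (13 + k * 4) (7 + k * 2) (solve (k ∷ []))
                  (moved (7 + k * 2) (7 + k * 2 + 0) (solve (k ∷ [])) (run-A+1 0 (s≤s z≤n))))
            (none-C (13 + k * 4) (≤-by (14 + k * 4) (16 + k * 6) (2 + k * 2) (solve (k ∷ []))))

  -- [2A+2, 3A-2): the A-options are the run [A+2, 2A-2), one letter ahead
  run-2A+2 : ∀ j → j < 2 + k * 2 → G (14 + k * 4 + j) ≡ bit j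
  run-2A+2 = run (14 + k * 4) (2 + k * 2) (start-after (13 + k * 4) G-2A+1 (λ ())) avoid
    where
    avoid : ∀ j → j < 2 + k * 2 → Avoids (bit j) (Opt (14 + k * 4 + j) A) × Avoids (bit j) (Opt (14 + k * 4 + j) C)
    avoid j j< = avoids (opt-A (14 + k * 4 + j) (7 + k * 2 + suc j) (solve (k ∷ j ∷ []))
          (run-A+1 (suc j) (≤-trans (s≤s j<) (≤-by (3 + k * 2) (6 + k * 2) 3 (solve (k ∷ [])))))) (bit-flip j)
           , avoids-nothing (none-C (14 + k * 4 + j)
                 (shifted-below (14 + k * 4) j (2 + k * 2) (16 + k * 6) j<
                       (≤-by (14 + k * 4 + (2 + k * 2)) (16 + k * 6) 0 (solve (k ∷ [])))))

  -- G(3A-2) = mex{G(3A-3), G(2A-2), G(0)} = mex{1, 1, 0}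
  G-3A-2 : G (16 + k * 6) ≡ 2
  G-3A-2 = G-from (16 + k * 6) (opt-1 (16 + k * 6) (15 + k * 6) (solve (k ∷ []))
        (moved (15 + k * 6) (14 + k * 4 + (1 + k * 2)) (solve (k ∷ []))
              (trans (run-2A+2 (1 + k * 2) (n<1+n _)) (bit-even 1 k))))
            (opt-A (16 + k * 6) (10 + k * 4) (solve (k ∷ []))
                  (moved (10 + k * 4) (7 + k * 2 + (3 + k * 2)) (solve (k ∷ []))
                        (trans (run-A+1 (3 + k * 2) (≤-by (4 + k * 2) (6 + k * 2) 2 (solve (k ∷ [])))) (bit-even 3 k))))
            (opt-C (16 + k * 6) 0 refl (run-0 0 (s≤s z≤n)))

  -- G(3A-1) = mex{G(3A-2), G(2A-1), G(1)} = mex{2, 0, 1}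
  G-3A-1 : G (17 + k * 6) ≡ 3
  G-3A-1 = G-from (17 + k * 6) (opt-1 (17 + k * 6) (16 + k * 6) (solve (k ∷ [])) G-3A-2)
            (opt-A (17 + k * 6) (11 + k * 4) (solve (k ∷ []))
                  (moved (11 + k * 4) (7 + k * 2 + (4 + k * 2)) (solve (k ∷ []))
                        (trans (run-A+1 (4 + k * 2) (≤-by (5 + k * 2) (6 + k * 2) 1 (solve (k ∷ [])))) (bit-even 4 k))))
            (opt-C (17 + k * 6) 1 (solve (k ∷ [])) (run-0 1 (s≤s (s≤s z≤n))))

  -- G(3A) = mex{G(3A-1), G(2A), G(2)} = mex{3, 1, 0}
  G-3A : G (18 + k * 6) ≡ 2
  G-3A = G-from (18 + k * 6) (opt-1 (18 + k * 6) (17 + k * 6) (solve (k ∷ [])) G-3A-1)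
            (opt-A (18 + k * 6) (12 + k * 4) (solve (k ∷ []))
                  (moved (12 + k * 4) (7 + k * 2 + (5 + k * 2)) (solve (k ∷ []))
                        (trans (run-A+1 (5 + k * 2) (n<1+n _)) (bit-even 5 k))))
            (opt-C (18 + k * 6) 2 (solve (k ∷ [])) (run-0 2 (s≤s (s≤s (s≤s z≤n)))))

  -- [3A+1, 4A-1): A-options G(2A+1) = 2, the run [2A+2, 3A-2) one letter
  -- behind, G(3A-2) = 2; C-options the run [3, A) one letter ahead, G(A) = 2
  run-3A+1 : ∀ j → j < 4 + k * 2 → G (19 + k * 6 + j) ≡ bit j
  run-3A+1 = run (19 + k * 6) (4 + k * 2) (start-after (18 + k * 6) G-3A (λ ()))
      (λ j j< → via-A j j< , via-C j (split-last j (3 + k * 2) j<))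
    where
    via-A-suc : ∀ j → j < 2 + k * 2 ⊎ j ≡ 2 + k * 2 → Avoids (bit (suc j)) (Opt (19 + k * 6 + suc j) A)
    via-A-suc j (inj₁ j<′) = avoids (opt-A (19 + k * 6 + suc j) (14 + k * 4 + j) (solve (k ∷ j ∷ [])) (run-2A+2 j j<′))
        (≢-sym (bit-flip j))
    via-A-suc .(2 + k * 2) (inj₂ refl) = avoids (opt-A (19 + k * 6 + suc (2 + k * 2)) (16 + k * 6)
          (solve (k ∷ [])) G-3A-2) (two≢bit (suc (2 + k * 2)))
    via-A : ∀ j → j < 4 + k * 2 → Avoids (bit j) (Opt (19 + k * 6 + j) A)
    via-A zero j< = avoids (opt-A (19 + k * 6 + 0) (13 + k * 4) (solve (k ∷ [])) G-2A+1) (two≢bit 0)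
    via-A (suc j) j< = via-A-suc j (split-last j (2 + k * 2) (≤-pred j<))
    via-C : ∀ j → j < 3 + k * 2 ⊎ j ≡ 3 + k * 2 → Avoids (bit j) (Opt (19 + k * 6 + j) C)
    via-C j (inj₁ j<′) = avoids (opt-C (19 + k * 6 + j) (3 + j) (solve (k ∷ j ∷ [])) (run-0 (3 + j) (+-monoʳ-< 3 j<′)))
        (bit-flip j)
    via-C .(3 + k * 2) (inj₂ refl) = avoids (opt-C (19 + k * 6 + (3 + k * 2)) (6 + k * 2) (solve (k ∷ [])) G-A)
        (two≢bit (3 + k * 2))

  -- G(4A-1) = mex{G(4A-2), G(3A-1), G(A+1)} = mex{1, 3, 0}
  G-4A-1 : G (23 + k * 8) ≡ 2
  G-4A-1 = G-from (23 + k * 8) (opt-1 (23 + k * 8) (22 + k * 8) (solve (k ∷ []))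
        (moved (22 + k * 8) (19 + k * 6 + (3 + k * 2)) (solve (k ∷ []))
              (trans (run-3A+1 (3 + k * 2) (n<1+n _)) (bit-even 3 k))))
             (opt-A (23 + k * 8) (17 + k * 6) (solve (k ∷ [])) G-3A-1)
             (opt-C (23 + k * 8) (7 + k * 2) (solve (k ∷ []))
                   (moved (7 + k * 2) (7 + k * 2 + 0) (solve (k ∷ [])) (run-A+1 0 (s≤s z≤n))))

  -- [4A, 5A): A-options G(3A) = 2, the run [3A+1, 4A-1), G(4A-1) = 2;
  -- C-options the run [A+2, 2A+1) one letter ahead, G(2A+1) = 2
  run-4A : ∀ j → j < 6 + k * 2 → G (24 + k * 8 + j) ≡ bit j
  run-4A = run (24 + k * 8) (6 + k * 2) (start-after (23 + k * 8) G-4A-1 (λ ()))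
      (λ j j< → via-A j j< , via-C j (split-last j (5 + k * 2) j<))
    where
    via-A-suc : ∀ j → j < 4 + k * 2 ⊎ j ≡ 4 + k * 2 → Avoids (bit (suc j)) (Opt (24 + k * 8 + suc j) A)
    via-A-suc j (inj₁ j<′) = avoids (opt-A (24 + k * 8 + suc j) (19 + k * 6 + j) (solve (k ∷ j ∷ [])) (run-3A+1 j j<′))
        (≢-sym (bit-flip j))
    via-A-suc .(4 + k * 2) (inj₂ refl) = avoids (opt-A (24 + k * 8 + suc (4 + k * 2)) (23 + k * 8)
          (solve (k ∷ [])) G-4A-1) (two≢bit (suc (4 + k * 2)))
    via-A : ∀ j → j < 6 + k * 2 → Avoids (bit j) (Opt (24 + k * 8 + j) A)
    via-A zero j< = avoids (opt-A (24 + k * 8 + 0) (18 + k * 6) (solve (k ∷ [])) G-3A) (two≢bit 0)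
    via-A (suc j) j< = via-A-suc j (split-last j (4 + k * 2) (≤-pred j<))
    via-C : ∀ j → j < 5 + k * 2 ⊎ j ≡ 5 + k * 2 → Avoids (bit j) (Opt (24 + k * 8 + j) C)
    via-C j (inj₁ j<′) = avoids (opt-C (24 + k * 8 + j) (7 + k * 2 + suc j) (solve (k ∷ j ∷ []))
          (run-A+1 (suc j) (s≤s j<′))) (bit-flip j)
    via-C .(5 + k * 2) (inj₂ refl) = avoids (opt-C (24 + k * 8 + (5 + k * 2)) (13 + k * 4) (solve (k ∷ [])) G-2A+1)
        (two≢bit (5 + k * 2))

  -- G(5A) = mex{G(5A-1), G(4A), G(2A+2)} = mex{1, 0, 0}
  G-5A : G (30 + k * 10) ≡ 2
  G-5A = G-from (30 + k * 10) (opt-1 (30 + k * 10) (29 + k * 10) (solve (k ∷ []))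
        (moved (29 + k * 10) (24 + k * 8 + (5 + k * 2)) (solve (k ∷ []))
              (trans (run-4A (5 + k * 2) (n<1+n _)) (bit-even 5 k))))
             (opt-A (30 + k * 10) (24 + k * 8) (solve (k ∷ []))
                   (moved (24 + k * 8) (24 + k * 8 + 0) (solve (k ∷ [])) (run-4A 0 (s≤s z≤n))))
             (opt-C (30 + k * 10) (14 + k * 4) (solve (k ∷ []))
                   (moved (14 + k * 4) (14 + k * 4 + 0) (solve (k ∷ [])) (run-2A+2 0 (s≤s z≤n))))

  -- [5A+1, 6A-1): A-options the run [4A+1, 5A) one letter ahead; C-options
  -- the run [2A+3, 3A-2), then G(3A-2) = 2, G(3A-1) = 3, G(3A) = 2
  run-5A+1 : ∀ j → j < 4 + k * 2 → G (31 + k * 10 + j) ≡ bit j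
  run-5A+1 = run (31 + k * 10) (4 + k * 2) (start-after (30 + k * 10) G-5A (λ ()))
      (λ j j< → via-A j j< , via-C j (split-last j (3 + k * 2) j<))
    where
    via-A : ∀ j → j < 4 + k * 2 → Avoids (bit j) (Opt (31 + k * 10 + j) A)
    via-A j j< = avoids (opt-A (31 + k * 10 + j) (24 + k * 8 + suc j) (solve (k ∷ j ∷ []))
          (run-4A (suc j) (≤-trans (s≤s j<) (≤-by (5 + k * 2) (6 + k * 2) 1 (solve (k ∷ [])))))) (bit-flip j)
    via-C₂ : ∀ j → j < 1 + k * 2 ⊎ j ≡ 1 + k * 2 → Avoids (bit j) (Opt (31 + k * 10 + j) C)
    via-C₂ j (inj₁ j<′) = avoids (opt-C (31 + k * 10 + j) (14 + k * 4 + suc j) (solve (k ∷ j ∷ []))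
          (run-2A+2 (suc j) (s≤s j<′))) (bit-flip j)
    via-C₂ .(1 + k * 2) (inj₂ refl) = avoids (opt-C (31 + k * 10 + (1 + k * 2)) (16 + k * 6) (solve (k ∷ [])) G-3A-2)
        (two≢bit (1 + k * 2))
    via-C₁ : ∀ j → j < 2 + k * 2 ⊎ j ≡ 2 + k * 2 → Avoids (bit j) (Opt (31 + k * 10 + j) C)
    via-C₁ j (inj₁ j<′) = via-C₂ j (split-last j (1 + k * 2) j<′)
    via-C₁ .(2 + k * 2) (inj₂ refl) = avoids (opt-C (31 + k * 10 + (2 + k * 2)) (17 + k * 6) (solve (k ∷ [])) G-3A-1)
        (three≢bit (2 + k * 2))
    via-C : ∀ j → j < 3 + k * 2 ⊎ j ≡ 3 + k * 2 → Avoids (bit j) (Opt (31 + k * 10 + j) C)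
    via-C j (inj₁ j<′) = via-C₁ j (split-last j (2 + k * 2) j<′)
    via-C .(3 + k * 2) (inj₂ refl) = avoids (opt-C (31 + k * 10 + (3 + k * 2)) (18 + k * 6) (solve (k ∷ [])) G-3A)
        (two≢bit (3 + k * 2))

  -- G(6A-1) = mex{G(6A-2), G(5A-1), G(3A+1)} = mex{1, 1, 0}
  G-6A-1 : G (35 + k * 12) ≡ 2
  G-6A-1 = G-from (35 + k * 12) (opt-1 (35 + k * 12) (34 + k * 12) (solve (k ∷ []))
        (moved (34 + k * 12) (31 + k * 10 + (3 + k * 2)) (solve (k ∷ []))
              (trans (run-5A+1 (3 + k * 2) (n<1+n _)) (bit-even 3 k))))
             (opt-A (35 + k * 12) (29 + k * 10) (solve (k ∷ []))
                   (moved (29 + k * 10) (24 + k * 8 + (5 + k * 2)) (solve (k ∷ []))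
                         (trans (run-4A (5 + k * 2) (n<1+n _)) (bit-even 5 k))))
             (opt-C (35 + k * 12) (19 + k * 6) (solve (k ∷ []))
                   (moved (19 + k * 6) (19 + k * 6 + 0) (solve (k ∷ [])) (run-3A+1 0 (s≤s z≤n))))

  -- [6A, 7A-2): the options follow the pattern of [3A+1, 4A-1), one period later
  run-6A : ∀ j → j < 4 + k * 2 → G (36 + k * 12 + j) ≡ bit j
  run-6A = run (36 + k * 12) (4 + k * 2) (start-after (35 + k * 12) G-6A-1 (λ ()))
      (λ j j< → via-A j j< , via-C j (split-last j (3 + k * 2) j<))
    where
    via-A : ∀ j → j < 4 + k * 2 → Avoids (bit j) (Opt (36 + k * 12 + j) A)
    via-A zero j< = avoids (opt-A (36 + k * 12 + 0) (30 + k * 10) (solve (k ∷ [])) G-5A) (two≢bit 0)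
    via-A (suc j) j< = avoids (opt-A (36 + k * 12 + suc j) (31 + k * 10 + j) (solve (k ∷ j ∷ []))
          (run-5A+1 j (≤-trans (n≤1+n (suc j)) j<))) (≢-sym (bit-flip j))
    via-C : ∀ j → j < 3 + k * 2 ⊎ j ≡ 3 + k * 2 → Avoids (bit j) (Opt (36 + k * 12 + j) C)
    via-C j (inj₁ j<′) = avoids (opt-C (36 + k * 12 + j) (19 + k * 6 + suc j) (solve (k ∷ j ∷ []))
          (run-3A+1 (suc j) (s≤s j<′))) (bit-flip j)
    via-C .(3 + k * 2) (inj₂ refl) = avoids (opt-C (36 + k * 12 + (3 + k * 2)) (23 + k * 8) (solve (k ∷ [])) G-4A-1)
        (two≢bit (3 + k * 2))

  -- G(7A-2) = mex{G(7A-3), G(6A-2), G(4A)} = mex{1, 1, 0}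
  G-7A-2 : G (40 + k * 14) ≡ 2
  G-7A-2 = G-from (40 + k * 14) (opt-1 (40 + k * 14) (39 + k * 14) (solve (k ∷ []))
        (moved (39 + k * 14) (36 + k * 12 + (3 + k * 2)) (solve (k ∷ []))
              (trans (run-6A (3 + k * 2) (n<1+n _)) (bit-even 3 k))))
             (opt-A (40 + k * 14) (34 + k * 12) (solve (k ∷ []))
                   (moved (34 + k * 12) (31 + k * 10 + (3 + k * 2)) (solve (k ∷ []))
                         (trans (run-5A+1 (3 + k * 2) (n<1+n _)) (bit-even 3 k))))
             (opt-C (40 + k * 14) (24 + k * 8) (solve (k ∷ []))
                   (moved (24 + k * 8) (24 + k * 8 + 0) (solve (k ∷ [])) (run-4A 0 (s≤s z≤n))))

  -- [7A-1, 8A-1): the options follow the pattern of [4A, 5A), one period later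
  run-7A-1 : ∀ j → j < 6 + k * 2 → G (41 + k * 14 + j) ≡ bit j
  run-7A-1 = run (41 + k * 14) (6 + k * 2) (start-after (40 + k * 14) G-7A-2 (λ ()))
      (λ j j< → via-A j j< , via-C j (split-last j (5 + k * 2) j<))
    where
    via-A-suc : ∀ j → j < 4 + k * 2 ⊎ j ≡ 4 + k * 2 → Avoids (bit (suc j)) (Opt (41 + k * 14 + suc j) A)
    via-A-suc j (inj₁ j<′) = avoids (opt-A (41 + k * 14 + suc j) (36 + k * 12 + j) (solve (k ∷ j ∷ [])) (run-6A j j<′))
        (≢-sym (bit-flip j))
    via-A-suc .(4 + k * 2) (inj₂ refl) = avoids (opt-A (41 + k * 14 + suc (4 + k * 2)) (40 + k * 14)
          (solve (k ∷ [])) G-7A-2) (two≢bit (suc (4 + k * 2)))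
    via-A : ∀ j → j < 6 + k * 2 → Avoids (bit j) (Opt (41 + k * 14 + j) A)
    via-A zero j< = avoids (opt-A (41 + k * 14 + 0) (35 + k * 12) (solve (k ∷ [])) G-6A-1) (two≢bit 0)
    via-A (suc j) j< = via-A-suc j (split-last j (4 + k * 2) (≤-pred j<))
    via-C : ∀ j → j < 5 + k * 2 ⊎ j ≡ 5 + k * 2 → Avoids (bit j) (Opt (41 + k * 14 + j) C)
    via-C j (inj₁ j<′) = avoids (opt-C (41 + k * 14 + j) (24 + k * 8 + suc j) (solve (k ∷ j ∷ []))
          (run-4A (suc j) (s≤s j<′))) (bit-flip j)
    via-C .(5 + k * 2) (inj₂ refl) = avoids (opt-C (41 + k * 14 + (5 + k * 2)) (30 + k * 10) (solve (k ∷ [])) G-5A)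
        (two≢bit (5 + k * 2))

  -- G(8A-1) = mex{G(8A-2), G(7A-1), G(5A+1)} = mex{1, 0, 0}
  G-8A-1 : G (47 + k * 16) ≡ 2
  G-8A-1 = G-from (47 + k * 16) (opt-1 (47 + k * 16) (46 + k * 16) (solve (k ∷ []))
        (moved (46 + k * 16) (41 + k * 14 + (5 + k * 2)) (solve (k ∷ []))
              (trans (run-7A-1 (5 + k * 2) (n<1+n _)) (bit-even 5 k))))
             (opt-A (47 + k * 16) (41 + k * 14) (solve (k ∷ []))
                   (moved (41 + k * 14) (41 + k * 14 + 0) (solve (k ∷ [])) (run-7A-1 0 (s≤s z≤n))))
             (opt-C (47 + k * 16) (31 + k * 10) (solve (k ∷ []))
                   (moved (31 + k * 10) (31 + k * 10 + 0) (solve (k ∷ [])) (run-5A+1 0 (s≤s z≤n))))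

  -- [8A, 9A-2): the options follow the pattern of [5A+1, 6A-1), one period later
  run-8A : ∀ j → j < 4 + k * 2 → G (48 + k * 16 + j) ≡ bit j
  run-8A = run (48 + k * 16) (4 + k * 2) (start-after (47 + k * 16) G-8A-1 (λ ()))
      (λ j j< → via-A j j< , via-C j (split-last j (3 + k * 2) j<))
    where
    via-A : ∀ j → j < 4 + k * 2 → Avoids (bit j) (Opt (48 + k * 16 + j) A)
    via-A j j< = avoids (opt-A (48 + k * 16 + j) (41 + k * 14 + suc j) (solve (k ∷ j ∷ []))
          (run-7A-1 (suc j) (≤-trans (s≤s j<) (≤-by (5 + k * 2) (6 + k * 2) 1 (solve (k ∷ [])))))) (bit-flip j)
    via-C : ∀ j → j < 3 + k * 2 ⊎ j ≡ 3 + k * 2 → Avoids (bit j) (Opt (48 + k * 16 + j) C)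
    via-C j (inj₁ j<′) = avoids (opt-C (48 + k * 16 + j) (31 + k * 10 + suc j) (solve (k ∷ j ∷ []))
          (run-5A+1 (suc j) (s≤s j<′))) (bit-flip j)
    via-C .(3 + k * 2) (inj₂ refl) = avoids (opt-C (48 + k * 16 + (3 + k * 2)) (35 + k * 12) (solve (k ∷ [])) G-6A-1)
        (two≢bit (3 + k * 2))


  data PeriodPos (d : ℕ) : Set where
    two₀  : d ≡ 0 → PeriodPos d
    bits₁ : ∀ j → j < 4 + k * 2 → d ≡ 1 + j → PeriodPos d
    two₁  : d ≡ 5 + k * 2 → PeriodPos d
    bits₂ : ∀ j → j < 6 + k * 2 → d ≡ 6 + k * 2 + j → PeriodPos d
    two₂  : d ≡ 12 + k * 4 → PeriodPos d
    bits₃ : ∀ j → j < 4 + k * 2 → d ≡ 13 + k * 4 + j → PeriodPos d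

  period-pos : ∀ d → d < 17 + k * 6 → PeriodPos d
  period-pos zero    _  = two₀ refl
  period-pos (suc d) d< with below-or-beyond d (4 + k * 2)
  ... | inj₁ d<      = bits₁ d d< refl
  ... | inj₂ (zero , d≡) = two₁ (cong suc (trans d≡ (+-identityʳ _)))
  ... | inj₂ (suc e , d≡) with below-or-beyond e (6 + k * 2)
  ...   | inj₁ e< = bits₂ e e< (trans (cong suc d≡) (solve (k ∷ e ∷ [])))
  ...   | inj₂ (zero , e≡) =
          two₂ (trans (cong suc d≡) (trans (cong (λ x → suc (4 + k * 2 + suc x)) e≡) (solve (k ∷ []))))
  ...   | inj₂ (suc f , e≡) = bits₃ f f< d≡′
    where
    d≡′ : suc d ≡ 13 + k * 4 + f
    d≡′ = trans (cong suc d≡) (trans (cong (λ x → suc (4 + k * 2 + suc x)) e≡) (solve (k ∷ f ∷ [])))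
    P-split : 17 + k * 6 ≡ 13 + k * 4 + (4 + k * 2)
    P-split = solve (k ∷ [])
    f< : f < 4 + k * 2
    f< = +-cancelˡ-< (13 + k * 4) f (4 + k * 2) (subst₂ _<_ d≡′ P-split d<)

  periodValue : ∀ {d} → PeriodPos d → ℕ
  periodValue (two₀ _)      = 2
  periodValue (bits₁ j _ _) = bit j
  periodValue (two₁ _)      = 2
  periodValue (bits₂ j _ _) = bit j
  periodValue (two₂ _)      = 2
  periodValue (bits₃ j _ _) = bit j

  -- the blocks starting at 3A and at 6A-1 = 3A + P carry the same values
  period-blocks : ∀ d (p : PeriodPos d) →
                  G (18 + k * 6 + d) ≡ periodValue p × G (35 + k * 12 + d) ≡ periodValue p
  period-blocks .0 (two₀ refl) =
    moved _ (18 + k * 6) (solve (k ∷ [])) G-3A , moved _ (35 + k * 12) (solve (k ∷ [])) G-6A-1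
  period-blocks .(1 + j) (bits₁ j j< refl) =
    moved _ (19 + k * 6 + j) (solve (k ∷ j ∷ [])) (run-3A+1 j j<) ,
    moved _ (36 + k * 12 + j) (solve (k ∷ j ∷ [])) (run-6A j j<)
  period-blocks .(5 + k * 2) (two₁ refl) =
    moved _ (23 + k * 8) (solve (k ∷ [])) G-4A-1 , moved _ (40 + k * 14) (solve (k ∷ [])) G-7A-2
  period-blocks .(6 + k * 2 + j) (bits₂ j j< refl) =
    moved _ (24 + k * 8 + j) (solve (k ∷ j ∷ [])) (run-4A j j<) ,
    moved _ (41 + k * 14 + j) (solve (k ∷ j ∷ [])) (run-7A-1 j j<)
  period-blocks .(12 + k * 4) (two₂ refl) =
    moved _ (30 + k * 10) (solve (k ∷ [])) G-5A , moved _ (47 + k * 16) (solve (k ∷ [])) G-8A-1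
  period-blocks .(13 + k * 4 + j) (bits₃ j j< refl) =
    moved _ (31 + k * 10 + j) (solve (k ∷ j ∷ [])) (run-5A+1 j j<) ,
    moved _ (48 + k * 16 + j) (solve (k ∷ j ∷ [])) (run-8A j j<)

  -- P is an eventual period from 3A on: two blocks cover a window of length C
  periodic : ∀ n → 18 + k * 6 ≤ n → G (n + P) ≡ G n
  periodic = periodic-from-window (18 + k * 6) P (s≤s z≤n) A≤C window
    where
    A≤C : A ≤ C
    A≤C = subst (6 + k * 2 ≤_) (sym C≡) (≤-by (6 + k * 2) (16 + k * 6) (10 + k * 4) (solve (k ∷ [])))
    window : ∀ n → 18 + k * 6 ≤ n → n < 18 + k * 6 + C → G (n + P) ≡ G n
    window n 3A≤n n< with offset (18 + k * 6) n 3A≤n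
    ... | d , refl = begin
      G (18 + k * 6 + d + P)    ≡⟨ cong G (trans (cong (18 + k * 6 + d +_) P≡) (solve (k ∷ d ∷ []))) ⟩
      G (35 + k * 12 + d)       ≡⟨ proj₂ (period-blocks d p) ⟩
      periodValue p             ≡⟨ sym (proj₁ (period-blocks d p)) ⟩
      G (18 + k * 6 + d)        ∎
      where
      open ≡-Reasoning
      d<P : d < 17 + k * 6
      d<P = <-trans (+-cancelˡ-< (18 + k * 6) d (16 + k * 6)
                      (subst (λ x → 18 + k * 6 + d < 18 + k * 6 + x) C≡ n<)) (n<1+n _)
      p : PeriodPos d
      p = period-pos d d<P


  smaller-shift-fails : ∀ q → 1 ≤ q → q < P → ∃ λ x → 18 + k * 6 ≤ x × G (x + q) ≢ G x
  smaller-shift-fails q 1≤q q<P with period-pos q (subst (q <_) P≡ q<P)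
  ... | two₀ refl = ⊥-elim (<-irrefl refl 1≤q)
  ... | p@(bits₁ j _ _) = 18 + k * 6 , ≤-refl ,
          values-differ (proj₁ (period-blocks q p)) G-3A (≢-sym (two≢bit j))
  ... | p@(bits₂ j _ _) = 18 + k * 6 , ≤-refl ,
          values-differ (proj₁ (period-blocks q p)) G-3A (≢-sym (two≢bit j))
  ... | p@(bits₃ j _ _) = 18 + k * 6 , ≤-refl ,
          values-differ (proj₁ (period-blocks q p)) G-3A (≢-sym (two≢bit j))
  ... | two₁ refl = 23 + k * 8 , ≤-by (18 + k * 6) (23 + k * 8) (5 + k * 2) (solve (k ∷ [])) ,
          values-differ (moved (23 + k * 8 + (5 + k * 2)) (24 + k * 8 + (4 + k * 2)) (solve (k ∷ []))
                           (trans (run-4A (4 + k * 2) (≤-by (5 + k * 2) (6 + k * 2) 1 (solve (k ∷ []))))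
                                 (bit-even 4 k)))
                        G-4A-1 (λ ())
  ... | two₂ refl = 30 + k * 10 , ≤-by (18 + k * 6) (30 + k * 10) (12 + k * 4) (solve (k ∷ [])) ,
          values-differ (moved (30 + k * 10 + (12 + k * 4)) (41 + k * 14 + 1) (solve (k ∷ []))
                (run-7A-1 1 (s≤s (s≤s z≤n))))
                        G-5A (λ ())

  isPeriod : IsPeriod S P
  isPeriod = least-period (18 + k * 6) P (subst (1 ≤_) (sym P≡) (s≤s z≤n)) periodic smaller-shift-fails

  -- the nim-sequence, read from 3A+1: (01)^{A/2-1} 2 (01)^{A/2} 2 (01)^{A/2-1} 2
  -- (assembled from its suffixes, to name them in the proofs below)
  suffix₂ : List ℕ
  suffix₂ = (2 ∷ []) ++ rep (2 + k) (0 ∷ 1 ∷ []) ++ (2 ∷ [])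

  suffix₁ : List ℕ
  suffix₁ = (2 ∷ []) ++ rep (3 + k) (0 ∷ 1 ∷ []) ++ suffix₂

  word : List ℕ
  word = rep (2 + k) (0 ∷ 1 ∷ []) ++ suffix₁

  word-length : length word ≡ P
  word-length = begin
    length word
      ≡⟨ alternating-length (2 + k) suffix₁ ⟩
    (2 + k) * 2 + suc (length (rep (3 + k) (0 ∷ 1 ∷ []) ++ suffix₂))
      ≡⟨ cong (λ t → (2 + k) * 2 + suc t) (alternating-length (3 + k) suffix₂) ⟩
    (2 + k) * 2 + suc ((3 + k) * 2 + suc (length (rep (2 + k) (0 ∷ 1 ∷ []) ++ (2 ∷ []))))
      ≡⟨ cong (λ t → (2 + k) * 2 + suc ((3 + k) * 2 + suc t)) (alternating-length (2 + k) (2 ∷ [])) ⟩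
    (2 + k) * 2 + suc ((3 + k) * 2 + suc ((2 + k) * 2 + 1))
      ≡⟨ solve (k ∷ []) ⟩
    17 + k * 6
      ≡⟨ sym P≡ ⟩
    P ∎
    where open ≡-Reasoning

  at-index : ∀ {i} i′ {x} → i ≡ i′ → nth word i′ ≡ x → nth word i ≡ x
  at-index i′ refl e = e

  word-letter : ∀ i (p : PeriodPos (suc i)) → nth word i ≡ just (periodValue p)
  word-letter i (two₀ ())
  word-letter i (bits₁ j j< e) = at-index j (suc-injective e) (alternating-nth (2 + k) suffix₁ j j<)
  word-letter i (two₁ e) =
    at-index ((2 + k) * 2 + 0) (trans (suc-injective e) (solve (k ∷ []))) (alternating-skip (2 + k) suffix₁ 0)
  word-letter i (bits₂ j j< e) =
    at-index ((2 + k) * 2 + suc j) (trans (suc-injective e) (solve (k ∷ j ∷ [])))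
      (trans (alternating-skip (2 + k) suffix₁ (suc j)) (alternating-nth (3 + k) suffix₂ j j<))
  word-letter i (two₂ e) =
    at-index ((2 + k) * 2 + suc ((3 + k) * 2 + 0)) (trans (suc-injective e) (solve (k ∷ [])))
      (trans (alternating-skip (2 + k) suffix₁ (suc ((3 + k) * 2 + 0))) (alternating-skip (3 + k) suffix₂ 0))
  word-letter i (bits₃ j j< e) =
    at-index ((2 + k) * 2 + suc ((3 + k) * 2 + suc j)) (trans (suc-injective e) (solve (k ∷ j ∷ [])))
      (trans (alternating-skip (2 + k) suffix₁ (suc ((3 + k) * 2 + suc j)))
        (trans (alternating-skip (3 + k) suffix₂ (suc j)) (alternating-nth (2 + k) (2 ∷ []) j j<)))

  -- the last letter closes the period: G(3A + P) = G(6A-1) = 2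
  word-values : ∀ i → i < P → nth word i ≡ just (G (19 + k * 6 + i))
  word-values i i<P with below-or-beyond i (16 + k * 6)
  ... | inj₁ i< = trans (word-letter i p)
                    (cong just (sym (moved (19 + k * 6 + i) (18 + k * 6 + suc i) (solve (k ∷ i ∷ []))
                              (proj₁ (period-blocks (suc i) p)))))
    where p = period-pos (suc i) (s≤s i<)
  ... | inj₂ (zero , i≡) =
    at-index ((2 + k) * 2 + suc ((3 + k) * 2 + suc ((2 + k) * 2 + 0))) (trans i≡ (solve (k ∷ [])))
      (trans (alternating-skip (2 + k) suffix₁ (suc ((3 + k) * 2 + suc ((2 + k) * 2 + 0))))
        (trans (alternating-skip (3 + k) suffix₂ (suc ((2 + k) * 2 + 0)))
          (trans (alternating-skip (2 + k) (2 ∷ []) 0)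
            (cong just (sym (moved (19 + k * 6 + i) (35 + k * 12) last G-6A-1))))))
    where
    last : 19 + k * 6 + i ≡ 35 + k * 12
    last = trans (cong (19 + k * 6 +_) (trans i≡ (+-identityʳ _))) (solve (k ∷ []))
  ... | inj₂ (suc e , refl) = ⊥-elim (<⇒≱ (subst (16 + k * 6 + suc e <_) P≡ i<P)
        (≤-by (17 + k * 6) (16 + k * 6 + suc e) e (solve (k ∷ e ∷ []))))

  ultimatelyPeriodic : UltimatelyPeriodic S P word
  ultimatelyPeriodic = ultimately-periodic (19 + k * 6) P word isPeriod
    (λ n 3A+1≤n → periodic n (≤-trans (n≤1+n _) 3A+1≤n)) word-length word-values

  periodic-m : ∀ m x → 18 + k * 6 ≤ x → G (x + m * P) ≡ G x
  periodic-m = periodic-multiple (18 + k * 6) P periodic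

  data TransientPos (n : ℕ) : Set where
    in-run-0    : ∀ j → j < 6 + k * 2 → n ≡ j → TransientPos n
    at-A        : n ≡ 6 + k * 2 → TransientPos n
    in-run-A+1  : ∀ j → j < 6 + k * 2 → n ≡ 7 + k * 2 + j → TransientPos n
    at-2A+1     : n ≡ 13 + k * 4 → TransientPos n
    in-run-2A+2 : ∀ j → j < 2 + k * 2 → n ≡ 14 + k * 4 + j → TransientPos n
    at-3A-2     : n ≡ 16 + k * 6 → TransientPos n

  transient-pos : ∀ n → n < 17 + k * 6 → TransientPos n
  transient-pos n n<P with below-or-beyond n (6 + k * 2)
  ... | inj₁ n<A = in-run-0 n n<A refl
  ... | inj₂ (zero , n≡) = at-A (trans n≡ (+-identityʳ _))
  ... | inj₂ (suc e , n≡) with below-or-beyond e (6 + k * 2)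
  ...   | inj₁ e<A = in-run-A+1 e e<A (trans n≡ (solve (k ∷ e ∷ [])))
  ...   | inj₂ (zero , e≡) = at-2A+1 (trans n≡ (trans (cong (λ t → 6 + k * 2 + suc t) e≡) (solve (k ∷ []))))
  ...   | inj₂ (suc f , e≡) with below-or-beyond f (2 + k * 2)
  ...     | inj₁ f< = in-run-2A+2 f f< (trans n≡ (trans (cong (λ t → 6 + k * 2 + suc t) e≡) (solve (k ∷ f ∷ []))))
  ...     | inj₂ (g , f≡) with trans n≡ (trans (cong (λ t → 6 + k * 2 + suc t) e≡)
                                  (cong (λ t → 6 + k * 2 + suc (6 + k * 2 + suc t)) f≡))
  ...       | n≡′ with g
  ...         | zero   = at-3A-2 (trans n≡′ (solve (k ∷ [])))
  ...         | suc g′ = ⊥-elim (<⇒≱ n<P (≤-by (17 + k * 6) n g′ (trans n≡′ (solve (k ∷ g′ ∷ [])))))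

  -- 3A belongs to the expansion.  In the periodic part n + 3A = (n+1) + P,
  -- so this is the move 1; on the transient the values are compared directly.
  shift-3A-changes : ∀ n → G (n + (18 + k * 6)) ≢ G n
  shift-3A-changes n with below-or-beyond n (17 + k * 6)
  ... | inj₁ n<P = transient n (transient-pos n n<P)
    where
    in-run-0-case : ∀ j → j < 6 + k * 2 → G (j + (18 + k * 6)) ≢ G j
    in-run-0-case zero j< = values-differ G-3A (run-0 0 j<) (λ ())
    in-run-0-case (suc j) j< with split-last j (4 + k * 2) (≤-pred j<)
    ... | inj₁ j<′ = values-differ (moved (suc j + (18 + k * 6)) (19 + k * 6 + j) (solve (k ∷ j ∷ [])) (run-3A+1 j j<′))
                       (run-0 (suc j) j<) (≢-sym (bit-flip j))
    ... | inj₂ refl = values-differ (moved (suc (4 + k * 2) + (18 + k * 6)) (23 + k * 8) (solve (k ∷ [])) G-4A-1)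
                        (run-0 (suc (4 + k * 2)) j<) (two≢bit (suc (4 + k * 2)))
    in-run-A+1-case : ∀ j → j < 6 + k * 2 → G (7 + k * 2 + j + (18 + k * 6)) ≢ G (7 + k * 2 + j)
    in-run-A+1-case j j< with split-last j (5 + k * 2) j<
    ... | inj₁ j<′ = values-differ (moved (7 + k * 2 + j + (18 + k * 6)) (24 + k * 8 + suc j) (solve (k ∷ j ∷ []))
          (run-4A (suc j) (s≤s j<′)))
                       (run-A+1 j j<) (bit-flip j)
    ... | inj₂ refl = values-differ (moved (7 + k * 2 + (5 + k * 2) + (18 + k * 6)) (30 + k * 10) (solve (k ∷ [])) G-5A)
                        (run-A+1 (5 + k * 2) j<) (two≢bit (5 + k * 2))
    transient : ∀ n → TransientPos n → G (n + (18 + k * 6)) ≢ G n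
    transient .j (in-run-0 j j< refl) = in-run-0-case j j<
    transient .(6 + k * 2) (at-A refl) =
      values-differ (moved (6 + k * 2 + (18 + k * 6)) (24 + k * 8 + 0) (solve (k ∷ [])) (run-4A 0 (s≤s z≤n))) G-A (λ ())
    transient .(7 + k * 2 + j) (in-run-A+1 j j< refl) = in-run-A+1-case j j<
    transient .(13 + k * 4) (at-2A+1 refl) =
      values-differ (moved (13 + k * 4 + (18 + k * 6)) (31 + k * 10 + 0) (solve (k ∷ []))
            (run-5A+1 0 (s≤s z≤n))) G-2A+1 (λ ())
    transient .(14 + k * 4 + j) (in-run-2A+2 j j< refl) =
      values-differ (moved (14 + k * 4 + j + (18 + k * 6)) (31 + k * 10 + suc j) (solve (k ∷ j ∷ []))
                      (run-5A+1 (suc j) (≤-trans (s≤s j<) (≤-by (3 + k * 2) (4 + k * 2) 1 (solve (k ∷ []))))))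
                    (run-2A+2 j j<) (bit-flip j)
    transient .(16 + k * 6) (at-3A-2 refl) =
      values-differ (trans (moved (16 + k * 6 + (18 + k * 6)) (31 + k * 10 + (3 + k * 2)) (solve (k ∷ []))
                              (run-5A+1 (3 + k * 2) (n<1+n _))) (bit-even 3 k))
                    G-3A-2 (λ ())
  ... | inj₂ (e , n≡) = λ G≡ → move-changes-value n 1 (here refl) (s≤s z≤n) (begin
    G (n + 1)                 ≡⟨ sym (periodic (n + 1)
          (≤-by (18 + k * 6) (n + 1) e (trans (cong (_+ 1) n≡) (solve (k ∷ e ∷ []))))) ⟩
    G (n + 1 + P)             ≡⟨ cong G (trans (cong (n + 1 +_) P≡) (solve (k ∷ n ∷ []))) ⟩
    G (n + (18 + k * 6))      ≡⟨ G≡ ⟩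
    G n                       ∎)
    where open ≡-Reasoning

  drop-periods : ∀ m n s → 18 + k * 6 ≤ n + s → G (n + (s + m * P)) ≡ G (n + s)
  drop-periods m n s in-period = trans (cong G (sym (+-assoc n s (m * P)))) (periodic-m m (n + s) in-period)

  -- 4A-1 + mP belongs to the expansion: for n ≥ 2A it acts like the move A
  -- (as 4A-1 = A + P); for n < 2A the values are compared directly.
  shift-4A-1-changes : ∀ m n → G (n + (23 + k * 8 + m * P)) ≢ G n
  shift-4A-1-changes m n with below-or-beyond n (12 + k * 4)
  ... | inj₁ n<2A = λ G≡ → transient (below-or-beyond n (6 + k * 2))
                      (trans (sym (drop-periods m n (23 + k * 8)
                                (≤-by (18 + k * 6) (n + (23 + k * 8)) (n + (5 + k * 2)) (solve (k ∷ n ∷ []))))) G≡)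
    where
    in-run-0-case : ∀ j → j < 6 + k * 2 → G (j + (23 + k * 8)) ≢ G j
    in-run-0-case zero    j< = values-differ G-4A-1 (run-0 0 j<) (λ ())
    in-run-0-case (suc j) j< =
      values-differ (moved (suc j + (23 + k * 8)) (24 + k * 8 + j) (solve (k ∷ j ∷ []))
            (run-4A j (≤-trans (n≤1+n _) j<)))
                    (run-0 (suc j) j<) (≢-sym (bit-flip j))
    in-run-A+1-case : ∀ e → e < 5 + k * 2 → G (6 + k * 2 + suc e + (23 + k * 8)) ≢ G (6 + k * 2 + suc e)
    in-run-A+1-case zero    _  =
      values-differ (moved (6 + k * 2 + 1 + (23 + k * 8)) (30 + k * 10) (solve (k ∷ [])) G-5A)
                    (moved (6 + k * 2 + 1) (7 + k * 2 + 0) (solve (k ∷ [])) (run-A+1 0 (s≤s z≤n))) (λ ())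
    in-run-A+1-case (suc e) e< =
      values-differ (moved (6 + k * 2 + suc (suc e) + (23 + k * 8)) (31 + k * 10 + e) (solve (k ∷ e ∷ []))
            (run-5A+1 e (≤-pred e<)))
                    (moved (6 + k * 2 + suc (suc e)) (7 + k * 2 + suc e) (solve (k ∷ e ∷ []))
                          (run-A+1 (suc e) (≤-trans e< (n≤1+n _))))
                    (≢-sym (bit-flip e))
    transient : n < 6 + k * 2 ⊎ ∃ (λ e → n ≡ 6 + k * 2 + e) → G (n + (23 + k * 8)) ≢ G n
    transient (inj₁ n<A) = in-run-0-case n n<A
    transient (inj₂ (zero , refl)) =
      values-differ (moved (6 + k * 2 + 0 + (23 + k * 8)) (24 + k * 8 + (5 + k * 2)) (solve (k ∷ []))
            (run-4A (5 + k * 2) (n<1+n _)))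
                    (moved (6 + k * 2 + 0) (6 + k * 2) (solve (k ∷ [])) G-A) (≢-sym (two≢bit (5 + k * 2)))
    transient (inj₂ (suc e , refl)) = in-run-A+1-case e
      (+-cancelˡ-< (7 + k * 2) e (5 + k * 2) (subst₂ _<_ n≡ 2A≡ n<2A))
      where
      n≡ : 6 + k * 2 + suc e ≡ 7 + k * 2 + e
      n≡ = solve (k ∷ e ∷ [])
      2A≡ : 12 + k * 4 ≡ 7 + k * 2 + (5 + k * 2)
      2A≡ = solve (k ∷ [])
  ... | inj₂ (e , n≡) = λ G≡ → move-changes-value n A (there (here refl)) (s≤s z≤n) (begin
    G (n + A)                         ≡⟨ sym (periodic-m (suc m) (n + A)
          (≤-by (18 + k * 6) (n + A) e (trans (cong (_+ (6 + k * 2)) n≡) (solve (k ∷ e ∷ []))))) ⟩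
    G (n + A + (P + m * P))           ≡⟨ cong G (trans (cong (λ p → n + A + (p + m * P)) P≡) (regroup n (m * P))) ⟩
    G (n + (23 + k * 8 + m * P))      ≡⟨ G≡ ⟩
    G n                               ∎)
    where
    open ≡-Reasoning
    regroup : ∀ n x → n + (6 + k * 2) + (17 + k * 6 + x) ≡ n + (23 + k * 8 + x)
    regroup n x = solve (k ∷ n ∷ x ∷ [])

  -- 6A-1 + mP = 3A + (m+1)P belongs to the expansion, by the case of 3A
  shift-6A-1-changes : ∀ m n → G (n + (35 + k * 12 + m * P)) ≢ G n
  shift-6A-1-changes m n G≡ = shift-3A-changes n (begin
    G (n + (18 + k * 6))                   ≡⟨ sym (periodic-m (suc m) (n + (18 + k * 6)) (m≤n+m _ n)) ⟩
    G (n + (18 + k * 6) + (P + m * P))     ≡⟨ cong G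
        (trans (cong (λ p → n + (18 + k * 6) + (p + m * P)) P≡) (regroup n (m * P))) ⟩
    G (n + (35 + k * 12 + m * P))          ≡⟨ G≡ ⟩
    G n                                    ∎)
    where
    open ≡-Reasoning
    regroup : ∀ n x → n + (18 + k * 6) + (17 + k * 6 + x) ≡ n + (35 + k * 12 + x)
    regroup n x = solve (k ∷ n ∷ x ∷ [])

  Expansion : ℕ → Set
  Expansion s = (s ≡ 1 ⊎ s ≡ A ⊎ s ≡ 3 * A ∸ 2 ⊎ s ≡ 3 * A)
              ⊎ Star (λ x → x ≡ 4 * A ∸ 1 ⊎ x ≡ 6 * A ∸ 1) (3 * A ∸ 1) s

  3A≡ : 3 * A ≡ 18 + k * 6
  3A≡ = normal-form k
    where
    normal-form : ∀ k → 3 * (6 + k * 2) ≡ 18 + k * 6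
    normal-form = solve-∀

  4A-1≡ : 4 * A ∸ 1 ≡ 23 + k * 8
  4A-1≡ = cong (_∸ 1) (normal-form k)
    where
    normal-form : ∀ k → 4 * (6 + k * 2) ≡ 24 + k * 8
    normal-form = solve-∀

  6A-1≡ : 6 * A ∸ 1 ≡ 35 + k * 12
  6A-1≡ = cong (_∸ 1) (normal-form k)
    where
    normal-form : ∀ k → 6 * (6 + k * 2) ≡ 36 + k * 12
    normal-form = solve-∀

  expansion-members : ∀ s → Expansion s → InExpansion S s
  expansion-members .1 (inj₁ (inj₁ refl)) = move-in-expansion 1 (here refl) (s≤s z≤n)
  expansion-members .A (inj₁ (inj₂ (inj₁ refl))) = move-in-expansion A (there (here refl)) (s≤s z≤n)
  expansion-members .C (inj₁ (inj₂ (inj₂ (inj₁ refl)))) =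
    move-in-expansion C (there (there (here refl))) (subst (1 ≤_) (sym C≡) (s≤s z≤n))
  expansion-members .(3 * A) (inj₁ (inj₂ (inj₂ (inj₂ refl)))) =
    in-expansion (3 * A) (s≤s z≤n) (λ n → subst (λ t → G (n + t) ≢ G n) (sym 3A≡) (shift-3A-changes n))
  expansion-members .(4 * A ∸ 1 + m * P) (inj₂ (.(4 * A ∸ 1) , m , inj₁ refl , refl)) =
    in-expansion _ (s≤s z≤n) (λ n → subst (λ t → G (n + (t + m * P)) ≢ G n) (sym 4A-1≡) (shift-4A-1-changes m n))
  expansion-members .(6 * A ∸ 1 + m * P) (inj₂ (.(6 * A ∸ 1) , m , inj₂ refl , refl)) =
    in-expansion _ (s≤s z≤n) (λ n → subst (λ t → G (n + (t + m * P)) ≢ G n) (sym 6A-1≡) (shift-6A-1-changes m n))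

  -- Converse.  Write s = ρ + mP with ρ < P.  Unless ρ ∈ {1, A, C} (where
  -- s is 1, A, C, 3A, 4A-1 + m′P or 6A-1 + m′P), some x repeats its value
  -- after the shift s.
  Changes : ℕ → Set
  Changes s = ∀ n → G (n + s) ≢ G n

  repeat-in-period : ∀ ρ m x → 18 + k * 6 ≤ x → ∀ {v} → G (x + ρ) ≡ v → G x ≡ v → ¬ Changes (ρ + m * P)
  repeat-in-period ρ m x in-period Gρ Gx changes =
    expansion-residue (18 + k * 6) P periodic ρ m changes x in-period (trans Gρ (sym Gx))

  zero-3A+1 : G (19 + k * 6) ≡ 0
  zero-3A+1 = moved (19 + k * 6) (19 + k * 6 + 0) (solve (k ∷ [])) (run-3A+1 0 (s≤s z≤n))

  zero-4A-3 : G (21 + k * 8) ≡ 0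
  zero-4A-3 = trans (moved (21 + k * 8) (19 + k * 6 + (2 + k * 2)) (solve (k ∷ []))
                      (run-3A+1 (2 + k * 2) (≤-by (3 + k * 2) (4 + k * 2) 1 (solve (k ∷ []))))) (bit-even 2 k)

  zero-4A : G (24 + k * 8) ≡ 0
  zero-4A = moved (24 + k * 8) (24 + k * 8 + 0) (solve (k ∷ [])) (run-4A 0 (s≤s z≤n))

  zero-5A-2 : G (28 + k * 10) ≡ 0
  zero-5A-2 = trans (moved (28 + k * 10) (24 + k * 8 + (4 + k * 2)) (solve (k ∷ []))
                      (run-4A (4 + k * 2) (≤-by (5 + k * 2) (6 + k * 2) 1 (solve (k ∷ []))))) (bit-even 4 k)

  zero-6A-3 : G (33 + k * 12) ≡ 0
  zero-6A-3 = trans (moved (33 + k * 12) (31 + k * 10 + (2 + k * 2)) (solve (k ∷ []))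
                      (run-5A+1 (2 + k * 2) (≤-by (3 + k * 2) (4 + k * 2) 1 (solve (k ∷ []))))) (bit-even 2 k)

  -- ρ = 1 + j with j ≥ 1: the value repeats at 4A (j even) or 4A-3 (j odd)
  residue-bits₁ : ∀ m j → suc j < 4 + k * 2 → ¬ Changes (1 + suc j + m * P)
  residue-bits₁ m j j< with even-or-odd j
  ... | inj₁ (t , refl) =
    repeat-in-period _ m (24 + k * 8) (≤-by (18 + k * 6) (24 + k * 8) (6 + k * 2) (solve (k ∷ [])))
      (trans (moved (24 + k * 8 + (1 + suc (t * 2))) (24 + k * 8 + (2 + t * 2)) (solve (k ∷ t ∷ []))
               (run-4A (2 + t * 2) (≤-trans (s≤s j<) (n≤1+n _)))) (bit-even 2 t))
      zero-4A
  ... | inj₂ (t , refl) =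
    repeat-in-period _ m (21 + k * 8) (≤-by (18 + k * 6) (21 + k * 8) (3 + k * 2) (solve (k ∷ [])))
      (trans (moved (21 + k * 8 + (1 + suc (suc (t * 2)))) (24 + k * 8 + t * 2) (solve (k ∷ t ∷ []))
               (run-4A (t * 2) (<-weaken j< (t * 2) (6 + k * 2) 2 2 (solve (k ∷ t ∷ [])) (solve (k ∷ [])))))
                 (bit-even 0 t))
      zero-4A-3

  -- ρ = A + 1 + j: the value repeats at 3A+1 (j even, j < A-2), at 6A-3
  -- (j odd), or, for ρ = 2A-1, at 0 (G(2A-1) = G(5A-2) = 0 = G(0))
  residue-bits₂ : ∀ m j → j < 5 + k * 2 → ¬ Changes (6 + k * 2 + suc j + m * P)
  residue-bits₂ m j j< with even-or-odd j
  ... | inj₁ (t , refl) with split-last (t * 2) (4 + k * 2) j<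
  ...   | inj₁ t< =
    repeat-in-period _ m (19 + k * 6) (≤-by (18 + k * 6) (19 + k * 6) 1 (solve (k ∷ [])))
      (trans (moved (19 + k * 6 + (6 + k * 2 + suc (t * 2))) (24 + k * 8 + (2 + t * 2)) (solve (k ∷ t ∷ []))
               (run-4A (2 + t * 2) (+-monoʳ-< 2 t<))) (bit-even 2 t))
      zero-3A+1
  ...   | inj₂ t≡ = λ changes → changes 0 (trans (value-2A-1 m) (sym (run-0 0 (s≤s z≤n))))
    where
    2A-1≡ : 6 + k * 2 + suc (4 + k * 2) + 0 ≡ 7 + k * 2 + (4 + k * 2)
    2A-1≡ = solve (k ∷ [])
    regroup : ∀ x → 6 + k * 2 + suc (4 + k * 2) + (17 + k * 6 + x) ≡ 28 + k * 10 + x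
    regroup x = solve (k ∷ x ∷ [])
    value-2A-1 : ∀ m → G (0 + (6 + k * 2 + suc (t * 2) + m * P)) ≡ 0
    value-2A-1 zero = trans (cong G (trans (cong (λ u → 6 + k * 2 + suc u + 0) t≡) 2A-1≡))
                        (trans (run-A+1 (4 + k * 2) (≤-by (5 + k * 2) (6 + k * 2) 1 (solve (k ∷ [])))) (bit-even 4 k))
    value-2A-1 (suc m′) = trans (cong G (trans (cong (λ u → 6 + k * 2 + suc u + (P + m′ * P)) t≡)
                                          (trans (cong (λ p → 6 + k * 2 + suc (4 + k * 2) + (p + m′ * P)) P≡)
                                                (regroup (m′ * P)))))
                            (trans (periodic-m m′ (28 + k * 10)
                                    (≤-by (18 + k * 6) (28 + k * 10) (10 + k * 4) (solve (k ∷ [])))) zero-5A-2)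
  residue-bits₂ m j j< | inj₂ (t , refl) =
    repeat-in-period _ m (33 + k * 12) (≤-by (18 + k * 6) (33 + k * 12) (15 + k * 6) (solve (k ∷ [])))
      (trans (moved (33 + k * 12 + (6 + k * 2 + suc (suc (t * 2)))) (41 + k * 14 + t * 2) (solve (k ∷ t ∷ []))
               (run-7A-1 (t * 2) (<-weaken j< (t * 2) (6 + k * 2) 1 1 (solve (k ∷ t ∷ [])) (solve (k ∷ [])))))
                 (bit-even 0 t))
      zero-6A-3

  -- ρ = 2A + 1 + j: the value repeats at 5A-2 (j even) or 3A+1 (j odd),
  -- except for ρ = C, where s = C or s = C + (m′+1)P repeats G(0) = 0
  residue-bits₃ : ∀ m j → j < 4 + k * 2 → Changes (13 + k * 4 + j + m * P) → Expansion (13 + k * 4 + j + m * P)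
  residue-bits₃ m j j< changes with split-last j (3 + k * 2) j<
  ... | inj₁ j<′ with even-or-odd j
  ...   | inj₁ (t , refl) = ⊥-elim (repeat-in-period _ m (28 + k * 10)
            (≤-by (18 + k * 6) (28 + k * 10) (10 + k * 4) (solve (k ∷ [])))
            (trans (moved (28 + k * 10 + (13 + k * 4 + t * 2)) (41 + k * 14 + t * 2) (solve (k ∷ t ∷ []))
                     (run-7A-1 (t * 2) (<-weaken j<′ (t * 2) (6 + k * 2) 0 3 (solve (k ∷ t ∷ [])) (solve (k ∷ [])))))
                       (bit-even 0 t))
            zero-5A-2 changes)
  ...   | inj₂ (t , refl) = ⊥-elim (repeat-in-period _ m (19 + k * 6)
            (≤-by (18 + k * 6) (19 + k * 6) 1 (solve (k ∷ [])))
            (trans (moved (19 + k * 6 + (13 + k * 4 + suc (t * 2))) (31 + k * 10 + (2 + t * 2)) (solve (k ∷ t ∷ []))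
                     (run-5A+1 (2 + t * 2) (s≤s j<′))) (bit-even 2 t))
            zero-3A+1 changes)
  residue-bits₃ zero .(3 + k * 2) j< changes | inj₂ refl =
    inj₁ (inj₂ (inj₂ (inj₁ (trans C-form (sym C≡)))))
    where
    C-form : 13 + k * 4 + (3 + k * 2) + 0 ≡ 16 + k * 6
    C-form = solve (k ∷ [])
  residue-bits₃ (suc m′) .(3 + k * 2) j< changes | inj₂ refl =
    ⊥-elim (changes 0 (trans (cong G C+P-form) (trans (periodic-m m′ (33 + k * 12) 3A≤6A-3)
                         (trans zero-6A-3 (sym (run-0 0 (s≤s z≤n)))))))
    where
    regroup : ∀ x → 13 + k * 4 + (3 + k * 2) + (17 + k * 6 + x) ≡ 33 + k * 12 + x
    regroup x = solve (k ∷ x ∷ [])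
    C+P-form : 0 + (13 + k * 4 + (3 + k * 2) + (P + m′ * P)) ≡ 33 + k * 12 + m′ * P
    C+P-form = trans (cong (λ p → 13 + k * 4 + (3 + k * 2) + (p + m′ * P)) P≡) (regroup (m′ * P))
    3A≤6A-3 : 18 + k * 6 ≤ 33 + k * 12
    3A≤6A-3 = ≤-by (18 + k * 6) (33 + k * 12) (15 + k * 6) (solve (k ∷ []))

  -- ρ = 1: s is 1, 3A = 1 + P, or 6A-1 + m′P = 1 + (m′+2)P
  residue-1 : ∀ m → Expansion (1 + 0 + m * P)
  residue-1 zero = inj₁ (inj₁ refl)
  residue-1 (suc zero) = inj₁ (inj₂ (inj₂ (inj₂ (trans (cong (λ p → 1 + (p + 0)) P≡) (trans 3A-form (sym 3A≡))))))
    where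
    3A-form : 1 + (17 + k * 6 + 0) ≡ 18 + k * 6
    3A-form = solve (k ∷ [])
  residue-1 (suc (suc m′)) = inj₂ (6 * A ∸ 1 , m′ , inj₂ refl ,
    trans (cong (λ p → 1 + (p + (p + m′ * P))) P≡) (trans (regroup (m′ * P)) (cong (_+ m′ * P) (sym 6A-1≡))))
    where
    regroup : ∀ x → 1 + (17 + k * 6 + (17 + k * 6 + x)) ≡ 35 + k * 12 + x
    regroup x = solve (k ∷ x ∷ [])

  -- ρ = A: s is A or 4A-1 + m′P = A + (m′+1)P
  residue-A : ∀ m → Expansion (6 + k * 2 + 0 + m * P)
  residue-A zero = inj₁ (inj₂ (inj₁ A-form))
    where
    A-form : 6 + k * 2 + 0 + 0 ≡ 6 + k * 2
    A-form = solve (k ∷ [])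
  residue-A (suc m′) = inj₂ (4 * A ∸ 1 , m′ , inj₁ refl ,
    trans (cong (λ p → 6 + k * 2 + 0 + (p + m′ * P)) P≡) (trans (regroup (m′ * P)) (cong (_+ m′ * P) (sym 4A-1≡))))
    where
    regroup : ∀ x → 6 + k * 2 + 0 + (17 + k * 6 + x) ≡ 23 + k * 8 + x
    regroup x = solve (k ∷ x ∷ [])

  residues : ∀ ρ m → Changes (ρ + m * P) → PeriodPos ρ → Expansion (ρ + m * P)
  residues .0 m changes (two₀ refl) =
    ⊥-elim (repeat-in-period 0 m (18 + k * 6) ≤-refl (cong G (+-identityʳ _)) refl changes)
  residues .(1 + 0) m changes (bits₁ zero _ refl) = residue-1 m
  residues .(1 + suc j) m changes (bits₁ (suc j) j< refl) = ⊥-elim (residue-bits₁ m j j< changes)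
  residues .(5 + k * 2) m changes (two₁ refl) =
    ⊥-elim (repeat-in-period _ m (21 + k * 8) (≤-by (18 + k * 6) (21 + k * 8) (3 + k * 2) (solve (k ∷ [])))
      (trans (moved (21 + k * 8 + (5 + k * 2)) (24 + k * 8 + (2 + k * 2)) (solve (k ∷ []))
               (run-4A (2 + k * 2) (≤-by (3 + k * 2) (6 + k * 2) 3 (solve (k ∷ []))))) (bit-even 2 k))
      zero-4A-3 changes)
  residues .(6 + k * 2 + 0) m changes (bits₂ zero _ refl) = residue-A m
  residues .(6 + k * 2 + suc j) m changes (bits₂ (suc j) j< refl) = ⊥-elim (residue-bits₂ m j (≤-pred j<) changes)
  residues .(12 + k * 4) m changes (two₂ refl) =
    ⊥-elim (repeat-in-period _ m (33 + k * 12) (≤-by (18 + k * 6) (33 + k * 12) (15 + k * 6) (solve (k ∷ [])))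
      (trans (moved (33 + k * 12 + (12 + k * 4)) (41 + k * 14 + (4 + k * 2)) (solve (k ∷ []))
               (run-7A-1 (4 + k * 2) (≤-by (5 + k * 2) (6 + k * 2) 1 (solve (k ∷ []))))) (bit-even 4 k))
      zero-6A-3 changes)
  residues .(13 + k * 4 + j) m changes (bits₃ j j< refl) = residue-bits₃ m j j< changes

  expansion : HasExpansion S Expansion
  expansion s = exact , expansion-members s
    where
    exact : InExpansion S s → Expansion s
    exact ex = subst Expansion (sym (m≡m%n+[m/n]*n s P))
      (residues (s % P) (s / P)
        (subst Changes (m≡m%n+[m/n]*n s P) (expansion-changes s ex))
        (period-pos (s % P) (subst (s % P <_) P≡ (m%n<n s P))))

theorem3p8 : (a : ℕ) → 4 ≤ a → 2 ∣ a →
    UltimatelyPeriodic (1 ∷ a ∷ (3 * a ∸ 2) ∷ []) (3 * a ∸ 1)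
      (rep (a / 2 ∸ 1) (0 ∷ 1 ∷ []) ++ (2 ∷ [])
        ++ rep (a / 2) (0 ∷ 1 ∷ []) ++ (2 ∷ [])
        ++ rep (a / 2 ∸ 1) (0 ∷ 1 ∷ []) ++ (2 ∷ []))
    × (a ≡ 4 → NonExpandable (1 ∷ a ∷ (3 * a ∸ 2) ∷ []))
    × (a ≢ 4 → HasExpansion (1 ∷ a ∷ (3 * a ∸ 2) ∷ [])
        (λ s → (s ≡ 1 ⊎ s ≡ a ⊎ s ≡ 3 * a ∸ 2 ⊎ s ≡ 3 * a)
          ⊎ Star (λ x → x ≡ 4 * a ∸ 1 ⊎ x ≡ 6 * a ∸ 1) (3 * a ∸ 1) s))
-- write a = 2h; h ≤ 1 contradicts a ≥ 4, h = 2 is CaseFour, h = 3 + k is CaseEven k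
-- (where a / 2 = 3 + k turns the claimed word into `word`)
theorem3p8 .(0 * 2) () (divides zero refl)
theorem3p8 .(1 * 2) (s≤s (s≤s ())) (divides 1 refl)
theorem3p8 .(2 * 2) _ (divides 2 refl) =
  CaseFour.ultimatelyPeriodic , (λ _ → CaseFour.nonExpandable) , (λ 4≢4 → ⊥-elim (4≢4 refl))
theorem3p8 .((3 + k) * 2) _ (divides (suc (suc (suc k))) refl) =
  subst (λ h → UltimatelyPeriodic S P (rep (h ∸ 1) (0 ∷ 1 ∷ []) ++ (2 ∷ [])
                  ++ rep h (0 ∷ 1 ∷ []) ++ (2 ∷ []) ++ rep (h ∸ 1) (0 ∷ 1 ∷ []) ++ (2 ∷ [])))
        (sym (m*n/n≡m (3 + k) 2)) ultimatelyPeriodic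
  , (λ ())
  , (λ _ → expansion)
  where open CaseEven k
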